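{- Let $\mathcal I=(G=(V,E),L)$ be a CacAP instance and $C\subseteq V$ with $|\delta_E(C)|=2$, and let $\mathcal I_C$ and $\mathcal I_{V\setminus C}$ be the two instances obtained by splitting $\mathcal I$ at $C$. If $\mathcal I$ is a Leaf-to-Leaf CacAP instance, then $\mathcal I_C$ and $\mathcal I_{V\setminus C}$ are Leaf-to-Leaf CacAP instances. More generally, if $p$ is the number of vertices of $G$ that are endpoints of a link in $L$ but are not leaves of $G$, then the total number of such vertices (link endpoints that are not leaves) in $\mathcal I_C$ and $\mathcal I_{V\setminus C}$ together is also $p$.
   Context: A cactus is a connected multigraph in which every edge lies in exactly one cycle (pairs of parallel edges count as cycles). A CacAP instance $(G,L)$ consists of a cactus $G=(V,E)$ and links $L\subseteq\binom V2$. Leaves are degree-$2$ vertices; Leaf-to-Leaf means every link joins two leaves. Contracting a vertex set $S$ replaces $S$ by a single vertex, deleting edges and links with both endpoints in $S$ and redirecting the endpoints in $S$ of the other edges and links to the new vertex. Splitting at $C$ (with $|\delta_E(C)|=2$) yields $\mathcal I_C$, obtained from $\mathcal I$ by contracting $V\setminus C$, and $\mathcal I_{V\setminus C}$, obtained from $\mathcal I$ by contracting $C$. -}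

module Defs where

open import Data.Bool using (Bool; true; false; if_then_else_; _∧_; _∨_; not; T)
open import Data.Nat using (ℕ; zero; suc; _%_; _≡ᵇ_)
open import Data.Nat.DivMod using (m%n<n)
open import Data.Fin using (Fin; toℕ; fromℕ<)
open import Data.Fin.Subset using (Subset; _∈_; _∉_; _⊆_; _─_; _∪_; ⁅_⁆)
open import Data.Vec using (lookup)
open import Data.List using (List; length; filterᵇ; map; allFin)
open import Data.Bool.ListAction using (any)
import Data.List as List
open import Data.List.Membership.Propositional using () renaming (_∈_ to _∈ₗ_)
open import Data.Product using (Σ; ∃; _×_; _,_; proj₁; proj₂)
open import Data.Sum using (_⊎_)
open import Relation.Binary.PropositionalEquality using (_≡_; _≢_)
open import Relation.Binary.Construct.Closure.ReflexiveTransitive using (Star)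
open import Relation.Nullary.Decidable using (⌊_⌋)
open import Function.Definitions using (Injective)
open import Function.Bundles using (_⇔_)

-- Vertices are elements of Fin N; an instance carries its own vertex set V ⊆ Fin N.
-- Edges and links are (unordered) pairs, stored as ordered pairs in lists
-- (lists, so that parallel edges of the multigraph are allowed).
Pair : ℕ → Set
Pair N = Fin N × Fin N

record Instance (N : ℕ) : Set where
  constructor inst
  field
    V : Subset N
    E : List (Pair N)
    L : List (Pair N)
open Instance public

_=ᵥ_ : ∀ {N} → Fin N → Fin N → Bool
x =ᵥ y = toℕ x ≡ᵇ toℕ y

Joins : ∀ {N} → Pair N → Fin N → Fin N → Set
Joins e a b = (proj₁ e ≡ a × proj₂ e ≡ b) ⊎ (proj₁ e ≡ b × proj₂ e ≡ a)

InBinom : ∀ {N} → Subset N → Pair N → Set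
InBinom V e = proj₁ e ∈ V × proj₂ e ∈ V × proj₁ e ≢ proj₂ e

Adj : ∀ {N} → List (Pair N) → Fin N → Fin N → Set
Adj {N} E u v = Σ (Pair N) λ e → e ∈ₗ E × Joins e u v

Connected : ∀ {N} → Instance N → Set
Connected I = ∀ u v → u ∈ V I → v ∈ V I → Star (Adj (E I)) u v

next : ∀ {k} → Fin (suc k) → Fin (suc k)
next {k} i = fromℕ< (m%n<n (suc (toℕ i)) (suc k))

-- Edges are referred to by their position in the edge list (multigraph).
EdgeIx : ∀ {N} → Instance N → Set
EdgeIx I = Fin (length (E I))

edgeAt : ∀ {N} (I : Instance N) → EdgeIx I → Pair N
edgeAt I = List.lookup (E I)

IsCycle : ∀ {N} (I : Instance N) → Subset (length (E I)) → Set
IsCycle {N} I K =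
  Σ ℕ λ j →
  Σ (Fin (suc (suc j)) → Fin N) λ vs →
  Σ (Fin (suc (suc j)) → EdgeIx I) λ es →
    Injective _≡_ _≡_ vs
  × Injective _≡_ _≡_ es
  × (∀ i → Joins (edgeAt I (es i)) (vs i) (vs (next i)))
  × (∀ x → (x ∈ K) ⇔ (∃ λ i → es i ≡ x))

EveryEdgeInUniqueCycle : ∀ {N} → Instance N → Set
EveryEdgeInUniqueCycle I =
  ∀ (x : EdgeIx I) →
    (∃ λ K → IsCycle I K × x ∈ K)
  × (∀ K K' → IsCycle I K → IsCycle I K' → x ∈ K → x ∈ K' → K ≡ K')

IsCactus : ∀ {N} → Instance N → Set
IsCactus I = (∀ e → e ∈ₗ E I → InBinom (V I) e)
           × Connected I × EveryEdgeInUniqueCycle I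

CacAP : ∀ {N} → Instance N → Set
CacAP I = IsCactus I × (∀ l → l ∈ₗ L I → InBinom (V I) l)

-- degree of v (number of edges incident to v; edges are never loops)
incidentᵇ : ∀ {N} → Fin N → Pair N → Bool
incidentᵇ v e = (proj₁ e =ᵥ v) ∨ (proj₂ e =ᵥ v)

deg : ∀ {N} → Instance N → Fin N → ℕ
deg I v = length (filterᵇ (incidentᵇ v) (E I))

Leaf : ∀ {N} → Instance N → Fin N → Set
Leaf I v = v ∈ V I × deg I v ≡ 2

leafᵇ : ∀ {N} → Instance N → Fin N → Bool
leafᵇ I v = lookup (V I) v ∧ (deg I v ≡ᵇ 2)

LeafToLeaf : ∀ {N} → Instance N → Set
LeafToLeaf I = ∀ l → l ∈ₗ L I → Leaf I (proj₁ l) × Leaf I (proj₂ l)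

endpointᵇ : ∀ {N} → Instance N → Fin N → Bool
endpointᵇ I v = any (incidentᵇ v) (L I)

nonLeafEndpoints : ∀ {N} → Instance N → ℕ
nonLeafEndpoints {N} I =
  length (filterᵇ (λ v → lookup (V I) v ∧ endpointᵇ I v ∧ not (leafᵇ I v)) (allFin N))

crossesᵇ : ∀ {N} → Subset N → Pair N → Bool
crossesᵇ C e = not (lookup C (proj₁ e) ≡ᵇool lookup C (proj₂ e))
  where
  _≡ᵇool_ : Bool → Bool → Bool
  true  ≡ᵇool b = b
  false ≡ᵇool b = not b

δE : ∀ {N} → Instance N → Subset N → List (Pair N)
δE I C = filterᵇ (crossesᵇ C) (E I)

-- Contracting S ⊆ V into the vertex r ∈ S (the name of the new vertex);
-- edges/links with both endpoints in S are deleted, endpoints in S are redirected to r.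
bothInᵇ : ∀ {N} → Subset N → Pair N → Bool
bothInᵇ S e = lookup S (proj₁ e) ∧ lookup S (proj₂ e)

redirect : ∀ {N} → Subset N → Fin N → Fin N → Fin N
redirect S r x = if lookup S x then r else x

contractList : ∀ {N} → Subset N → Fin N → List (Pair N) → List (Pair N)
contractList S r xs =
  map (λ e → redirect S r (proj₁ e) , redirect S r (proj₂ e))
      (filterᵇ (λ e → not (bothInᵇ S e)) xs)

contract : ∀ {N} → Instance N → Subset N → Fin N → Instance N
contract I S r = inst ((V I ─ S) ∪ ⁅ r ⁆) (contractList S r (E I)) (contractList S r (L I))

-- Splitting at C: I_C contracts V∖C (into u ∈ V∖C), I_{V∖C} contracts C (into c ∈ C).
splitC : ∀ {N} → Instance N → Subset N → Fin N → Instance N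
splitC I C u = contract I (V I ─ C) u

splitCompl : ∀ {N} → Instance N → Subset N → Fin N → Instance N
splitCompl I C c = contract I C c

{-# OPTIONS --safe #-}
-- Contracting a set S with |δ_E(S)| = 2 into a vertex r keeps the vertices outside S together with
-- their degrees and link incidences, and gives r degree |δ_E(S)| = 2, so r is a leaf. Hence leaves
-- remain leaves, and a non-leaf link endpoint of I is one in exactly the split instance where it is
-- not contracted.
-- The cactus structure survives because a cycle crossing the cut does so at least twice, hence in
-- exactly the two cut edges: a cycle of G either stays on one side of the cut (and survives
-- unchanged or disappears) or uses both cut edges, and then its part outside S closed up at r is a
-- cycle of the contraction. Conversely a cycle of the contraction through r is completed inside S
-- by the S-part of the cycle of G through the two cut edges, so uniqueness of cycles transfers.
module Submission where

open import Defs
open import Data.Bool using (Bool; true; false; _∧_; _∨_; not)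
import Data.Bool.Properties as BP
open import Data.Bool.ListAction using (any)
open import Data.Empty using (⊥; ⊥-elim)
open import Data.Fin as F using (Fin; toℕ)
import Data.Fin.Properties as FP
open import Data.Fin.Subset using (Subset; _∈_; _∉_; _⊆_; _─_; _∪_; ⁅_⁆)
import Data.Fin.Subset.Properties as SP
open import Data.List as List using (List; []; _∷_; length; filterᵇ; map; allFin; _++_; [_])
import Data.List.Properties as LP
open import Data.List.Membership.Propositional using () renaming (_∈_ to _∈ₗ_)
import Data.List.Membership.Propositional.Properties as MP
open import Data.List.Relation.Binary.Permutation.Propositional using (_↭_; ↭-sym; ↭-trans; ↭-reflexive; ↭⇒↭ₛ)
import Data.List.Relation.Binary.Permutation.Setoid.Properties as PermSetoid
import Data.List.Relation.Binary.Permutation.Propositional.Properties as PP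
open import Data.List.Relation.Unary.All as All using (All; []; _∷_)
import Data.List.Relation.Unary.All.Properties as AP
import Data.List.Relation.Unary.Any.Properties as AnyP
open import Data.List.Relation.Unary.AllPairs using ([]; _∷_)
open import Data.List.Relation.Unary.Any as Any using (here; there)
open import Data.List.Relation.Unary.Unique.Propositional using (Unique)
import Data.List.Relation.Unary.Unique.Propositional.Properties as UP
open import Data.Nat using (ℕ; zero; suc; _+_; _≤_; _<_; z≤n; s≤s; _∸_)
import Data.Nat.Properties as ℕP
open import Data.Nat.DivMod using (_%_; m<n⇒m%n≡m; n%n≡0)
open import Data.Product using (Σ; ∃; _×_; _,_; proj₁; proj₂)
open import Data.Sum using (_⊎_; inj₁; inj₂)
open import Data.Vec as Vec using (lookup)
open import Data.Vec using () renaming (_∷_ to _∷ᵥ_)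
import Data.Vec.Properties as VP
open import Function.Base using (_∘_)
open import Function.Bundles using (_⇔_; mk⇔; Equivalence)
open import Function.Definitions using (Injective)
open import Relation.Binary.Construct.Closure.ReflexiveTransitive using (Star; ε; _◅_)
open import Relation.Binary.PropositionalEquality hiding ([_]; J)
open import Relation.Nullary using (¬_; Dec; yes; no)
open import Relation.Nullary.Decidable using (⌊_⌋; toWitness; fromWitness)

=ᵥ⇒≡ : ∀ {N} {x y : Fin N} → (x =ᵥ y) ≡ true → x ≡ y
=ᵥ⇒≡ {x = x} {y} e = FP.toℕ-injective (ℕP.≡ᵇ⇒≡ (toℕ x) (toℕ y) (Equivalence.from BP.T-≡ e))

=ᵥ-refl : ∀ {N} (x : Fin N) → (x =ᵥ x) ≡ true
=ᵥ-refl x = Equivalence.to BP.T-≡ (ℕP.≡⇒≡ᵇ (toℕ x) (toℕ x) refl)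

≢⇒=ᵥ-false : ∀ {N} {x y : Fin N} → x ≢ y → (x =ᵥ y) ≡ false
≢⇒=ᵥ-false {x = x} {y} ne with x =ᵥ y in e
... | true = ⊥-elim (ne (=ᵥ⇒≡ e))
... | false = refl

true≢false : true ≢ false
true≢false ()

∈⇒lookup : ∀ {N} {S : Subset N} {x} → x ∈ S → lookup S x ≡ true
∈⇒lookup = VP.[]=⇒lookup

lookup⇒∈ : ∀ {N} {S : Subset N} {x} → lookup S x ≡ true → x ∈ S
lookup⇒∈ {S = S} {x} = VP.lookup⇒[]= x S

∉⇒lookup : ∀ {N} {S : Subset N} {x} → x ∉ S → lookup S x ≡ false
∉⇒lookup n = BP.¬-not (λ e → n (lookup⇒∈ e))

length-filter-map-filter : ∀ {A B : Set} (p : B → Bool) (f : A → B) (q g : A → Bool) →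
       (∀ e → (q e ∧ p (f e)) ≡ g e) → ∀ xs →
       length (filterᵇ p (map f (filterᵇ q xs))) ≡ length (filterᵇ g xs)
length-filter-map-filter p f q g h [] = refl
length-filter-map-filter p f q g h (x ∷ xs) with q x in e1
... | false rewrite sym (h x) | e1 = length-filter-map-filter p f q g h xs
... | true with p (f x) in e2
...   | true rewrite sym (h x) | e1 | e2 = cong suc (length-filter-map-filter p f q g h xs)
...   | false rewrite sym (h x) | e1 | e2 = length-filter-map-filter p f q g h xs

any-map-filter : ∀ {A B : Set} (p : B → Bool) (f : A → B) (q g : A → Bool) →
       (∀ e → (q e ∧ p (f e)) ≡ g e) → ∀ xs →
       any p (map f (filterᵇ q xs)) ≡ any g xs
any-map-filter p f q g h [] = refl
any-map-filter p f q g h (x ∷ xs) with q x in e1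
... | false rewrite sym (h x) | e1 = any-map-filter p f q g h xs
... | true with p (f x) in e2
...   | true rewrite sym (h x) | e1 | e2 = refl
...   | false rewrite sym (h x) | e1 | e2 = any-map-filter p f q g h xs

filterᵇ-cong : ∀ {A : Set} (p q : A → Bool) → ∀ xs →
  (∀ e → e ∈ₗ xs → p e ≡ q e) → filterᵇ p xs ≡ filterᵇ q xs
filterᵇ-cong p q [] h = refl
filterᵇ-cong p q (x ∷ xs) h rewrite h x (here refl) with q x
... | true = cong (x ∷_) (filterᵇ-cong p q xs (λ e m → h e (there m)))
... | false = filterᵇ-cong p q xs (λ e m → h e (there m))

true-or-false : ∀ (b : Bool) → b ≡ true ⊎ b ≡ false
true-or-false true = inj₁ refl
true-or-false false = inj₂ refl

lookup-─ : ∀ {n} (p q : Subset n) x → lookup (p ─ q) x ≡ (lookup p x ∧ not (lookup q x))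
lookup-─ (a ∷ᵥ p) (true ∷ᵥ q) F.zero = sym (BP.∧-zeroʳ a)
lookup-─ (a ∷ᵥ p) (false ∷ᵥ q) F.zero = sym (BP.∧-identityʳ a)
lookup-─ (a ∷ᵥ p) (b ∷ᵥ q) (F.suc x) = lookup-─ p q x

lookup-∪ : ∀ {n} (p q : Subset n) x → lookup (p ∪ q) x ≡ (lookup p x ∨ lookup q x)
lookup-∪ p q x = VP.lookup-zipWith _∨_ x p q

∈-filterᵇ⁺ : ∀ {A : Set} (p : A → Bool) {x xs} → x ∈ₗ xs → p x ≡ true → x ∈ₗ filterᵇ p xs
∈-filterᵇ⁺ p {xs = y ∷ xs} (here refl) px rewrite px = here refl
∈-filterᵇ⁺ p {xs = y ∷ xs} (there m) px with p y
... | true = there (∈-filterᵇ⁺ p m px)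
... | false = ∈-filterᵇ⁺ p m px

∈-filterᵇ⁻ : ∀ {A : Set} (p : A → Bool) {x} xs → x ∈ₗ filterᵇ p xs → x ∈ₗ xs × p x ≡ true
∈-filterᵇ⁻ p (y ∷ xs) m with p y in e
∈-filterᵇ⁻ p (y ∷ xs) (here refl) | true = here refl , e
∈-filterᵇ⁻ p (y ∷ xs) (there m) | true = there (proj₁ (∈-filterᵇ⁻ p xs m)) , proj₂ (∈-filterᵇ⁻ p xs m)
... | false = there (proj₁ (∈-filterᵇ⁻ p xs m)) , proj₂ (∈-filterᵇ⁻ p xs m)

lookup-─-inside : ∀ {n} (p q : Subset n) {x} → lookup q x ≡ true → lookup (p ─ q) x ≡ false
lookup-─-inside p q {x} e rewrite lookup-─ p q x | e = BP.∧-zeroʳ _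

lookup-─-outside : ∀ {n} (p q : Subset n) {x} → lookup q x ≡ false → lookup (p ─ q) x ≡ lookup p x
lookup-─-outside p q {x} e rewrite lookup-─ p q x | e = BP.∧-identityʳ _

─⊆ : ∀ {n} (p q : Subset n) → p ─ q ⊆ p
─⊆ p q {x} m with true-or-false (lookup q x)
... | inj₁ e = ⊥-elim (true≢false (trans (sym (∈⇒lookup m)) (lookup-─-inside p q e)))
... | inj₂ e = lookup⇒∈ (trans (sym (lookup-─-outside p q e)) (∈⇒lookup m))


length-filter-∘ : ∀ {A B : Set} (p : B → Bool) (f : A → B) xs → length (filterᵇ (p ∘ f) xs) ≡ length (filterᵇ p (map f xs))
length-filter-∘ p f [] = refl
length-filter-∘ p f (x ∷ xs) with p (f x)
... | true = cong suc (length-filter-∘ p f xs)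
... | false = length-filter-∘ p f xs

length-filter-indices : ∀ {A : Set} (p : A → Bool) xs → length (filterᵇ (p ∘ List.lookup xs) (allFin (length xs))) ≡ length (filterᵇ p xs)
length-filter-indices p xs = trans (length-filter-∘ p (List.lookup xs) (allFin (length xs)))
  (cong (λ l → length (filterᵇ p l)) (trans (LP.map-tabulate (λ i → i) (List.lookup xs)) (LP.tabulate-lookup xs)))

length-filter-∨-disjoint : ∀ {A : Set} (p q h : A → Bool) → (∀ v → (p v ∧ q v) ≡ false) → (∀ v → h v ≡ (p v ∨ q v)) →
  ∀ xs → length (filterᵇ p xs) + length (filterᵇ q xs) ≡ length (filterᵇ h xs)
length-filter-∨-disjoint p q h d e [] = refl
length-filter-∨-disjoint p q h d e (x ∷ xs) rewrite e x with p x in ep | q x in eq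
... | true | true = ⊥-elim (true≢false (trans (sym (cong₂ _∧_ ep eq)) (d x)))
... | true | false = cong suc (length-filter-∨-disjoint p q h d e xs)
... | false | true = trans (ℕP.+-suc _ _) (cong suc (length-filter-∨-disjoint p q h d e xs))
... | false | false = length-filter-∨-disjoint p q h d e xs

module FilterMapIndex {A B : Set} (q : A → Bool) (f : A → B) where
  origin : ∀ xs → Fin (length (map f (filterᵇ q xs))) → Fin (length xs)
  origin (x ∷ xs) i with q x
  origin (x ∷ xs) F.zero | true = F.zero
  origin (x ∷ xs) (F.suc i) | true = F.suc (origin xs i)
  origin (x ∷ xs) i | false = F.suc (origin xs i)

  lookup-origin : ∀ xs i → List.lookup (map f (filterᵇ q xs)) i ≡ f (List.lookup xs (origin xs i))
  lookup-origin (x ∷ xs) i with q x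
  lookup-origin (x ∷ xs) F.zero | true = refl
  lookup-origin (x ∷ xs) (F.suc i) | true = lookup-origin xs i
  lookup-origin (x ∷ xs) i | false = lookup-origin xs i

  origin-kept : ∀ xs i → q (List.lookup xs (origin xs i)) ≡ true
  origin-kept (x ∷ xs) i with q x in e
  origin-kept (x ∷ xs) F.zero | true = e
  origin-kept (x ∷ xs) (F.suc i) | true = origin-kept xs i
  origin-kept (x ∷ xs) i | false = origin-kept xs i

  origin-injective : ∀ xs {i k} → origin xs i ≡ origin xs k → i ≡ k
  origin-injective (x ∷ xs) {i} {k} e with q x
  origin-injective (x ∷ xs) {F.zero} {F.zero} e | true = refl
  origin-injective (x ∷ xs) {F.suc i} {F.suc k} e | true = cong F.suc (origin-injective xs (FP.suc-injective e))
  origin-injective (x ∷ xs) {i} {k} e | false = origin-injective xs (FP.suc-injective e)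

  origin-surjective : ∀ xs k → q (List.lookup xs k) ≡ true → ∃ λ i → origin xs i ≡ k
  origin-surjective (x ∷ xs) k e with q x in e'
  origin-surjective (x ∷ xs) F.zero e | true = F.zero , refl
  origin-surjective (x ∷ xs) (F.suc k) e | true with origin-surjective xs k e
  ... | i , p = F.suc i , cong F.suc p
  origin-surjective (x ∷ xs) F.zero e | false = ⊥-elim (true≢false (trans (sym e) e'))
  origin-surjective (x ∷ xs) (F.suc k) e | false with origin-surjective xs k e
  ... | i , p = i , cong F.suc p

Unique-resp-↭ : ∀ {A : Set} {xs ys : List A} → xs ↭ ys → Unique xs → Unique ys
Unique-resp-↭ {A} p = PermSetoid.Unique-resp-↭ (setoid A) (↭⇒↭ₛ p)

Unique-++⁻ : ∀ {A : Set} (xs : List A) {ys} → Unique (xs ++ ys) →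
  Unique xs × Unique ys × (∀ {z} → z ∈ₗ xs → z ∈ₗ ys → ⊥)
Unique-++⁻ [] u = [] , u , (λ ())
Unique-++⁻ (x ∷ xs) (a ∷ u) with Unique-++⁻ xs u
... | u1 , u2 , d = (All.tabulate (λ m → All.lookup a (MP.∈-++⁺ˡ m)) ∷ u1) , u2 , dj
  where
  dj : ∀ {z} → z ∈ₗ (x ∷ xs) → z ∈ₗ _ → ⊥
  dj (here refl) m2 = All.lookup a (MP.∈-++⁺ʳ xs m2) refl
  dj (there m1) m2 = d m1 m2

Unique-++⁺ : ∀ {A : Set} {xs ys : List A} → Unique xs → Unique ys →
  (∀ {z} → z ∈ₗ xs → z ∈ₗ ys → ⊥) → Unique (xs ++ ys)
Unique-++⁺ u1 u2 d = UP.++⁺ u1 u2 (λ (m1 , m2) → d m1 m2)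

head∉tail : ∀ {A : Set} {x : A} {xs} → Unique (x ∷ xs) → ∀ {z} → z ∈ₗ xs → x ≢ z
head∉tail (a ∷ _) m = All.lookup a m

Unique-tail : ∀ {A : Set} {x : A} {xs} → Unique (x ∷ xs) → Unique xs
Unique-tail (_ ∷ u) = u

rotate-snoc-↭ : ∀ {A : Set} (xs : List A) x ys → ys ++ (xs ++ [ x ]) ↭ xs ++ x ∷ ys
rotate-snoc-↭ xs x ys = ↭-trans (PP.++-comm ys (xs ++ [ x ])) (↭-reflexive (LP.++-assoc xs [ x ] ys))

Unique-⊆⇒length≤ : ∀ {A : Set} {xs ys : List A} → Unique xs → (∀ {z} → z ∈ₗ xs → z ∈ₗ ys) → length xs ≤ length ys
Unique-⊆⇒length≤ {xs = []} u h = z≤n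
Unique-⊆⇒length≤ {xs = x ∷ xs} {ys} (a ∷ u) h with MP.∈-∃++ (h (here refl))
... | ys1 , ys2 , refl = ℕP.≤-trans (s≤s (Unique-⊆⇒length≤ u h')) (ℕP.≤-reflexive (sym lenEq))
  where
  h' : ∀ {z} → z ∈ₗ xs → z ∈ₗ ys1 ++ ys2
  h' {z} m with MP.∈-++⁻ ys1 (h (there m))
  ... | inj₁ m1 = MP.∈-++⁺ˡ m1
  ... | inj₂ (here refl) = ⊥-elim (All.lookup a m refl)
  ... | inj₂ (there m2) = MP.∈-++⁺ʳ ys1 m2
  lenEq : length (ys1 ++ x ∷ ys2) ≡ suc (length (ys1 ++ ys2))
  lenEq = trans (LP.length-++ ys1) (trans (ℕP.+-suc (length ys1) (length ys2)) (cong suc (sym (LP.length-++ ys1))))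

Unique⇒lookup-injective : ∀ {A : Set} {xs : List A} → Unique xs → ∀ {i j} → List.lookup xs i ≡ List.lookup xs j → i ≡ j
Unique⇒lookup-injective {xs = x ∷ xs} u {F.zero} {F.zero} e = refl
Unique⇒lookup-injective {xs = x ∷ xs} (a ∷ u) {F.zero} {F.suc j} e = ⊥-elim (All.lookup a (MP.∈-lookup j) e)
Unique⇒lookup-injective {xs = x ∷ xs} (a ∷ u) {F.suc i} {F.zero} e = ⊥-elim (All.lookup a (MP.∈-lookup i) (sym e))
Unique⇒lookup-injective {xs = x ∷ xs} (a ∷ u) {F.suc i} {F.suc j} e = cong F.suc (Unique⇒lookup-injective u e)

2≤length-++∷++[] : ∀ {A : Set} (xs : List A) x ys y → 2 ≤ length (xs ++ x ∷ ys ++ [ y ])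
2≤length-++∷++[] [] x [] y = s≤s (s≤s z≤n)
2≤length-++∷++[] [] x (z ∷ ys) y = s≤s (s≤s z≤n)
2≤length-++∷++[] (w ∷ xs) x ys y = ℕP.m≤n⇒m≤1+n (2≤length-++∷++[] xs x ys y)

3≰2 : ¬ (3 ≤ 2)
3≰2 (s≤s (s≤s ()))

toℕ-next≡ : ∀ {m} (i : Fin (suc m)) → toℕ (next i) ≡ suc (toℕ i) % suc m
toℕ-next≡ {m} i = FP.toℕ-fromℕ< _

next-cases : ∀ {m} (i : Fin (suc m)) → (toℕ i < m × toℕ (next i) ≡ suc (toℕ i)) ⊎ (toℕ i ≡ m × toℕ (next i) ≡ 0)
next-cases {m} i with ℕP.m≤n⇒m<n∨m≡n (FP.toℕ≤pred[n] i)
... | inj₁ lt = inj₁ (lt , trans (toℕ-next≡ i) (m<n⇒m%n≡m (s≤s lt)))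
... | inj₂ eq = inj₂ (eq , trans (toℕ-next≡ i) (trans (cong (λ z → suc z % suc m) eq) (n%n≡0 (suc m))))

next-injective : ∀ {m} {i k : Fin (suc m)} → next i ≡ next k → i ≡ k
next-injective {m} {i} {k} e with next-cases i | next-cases k
... | inj₁ (_ , a) | inj₁ (_ , b) = FP.toℕ-injective (ℕP.suc-injective (trans (sym a) (trans (cong toℕ e) b)))
... | inj₂ (a , _) | inj₂ (b , _) = FP.toℕ-injective (trans a (sym b))
... | inj₁ (_ , a) | inj₂ (_ , b) with () ← trans (sym a) (trans (cong toℕ e) b)
... | inj₂ (_ , a) | inj₁ (_ , b) with () ← trans (sym b) (trans (cong toℕ (sym e)) a)

next-surjective : ∀ {m} (t : Fin (suc m)) → ∃ λ i → next i ≡ t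
next-surjective {m} t with toℕ t in et
... | zero = F.fromℕ m , FP.toℕ-injective (lem (next-cases (F.fromℕ m)))
  where
  lem : _ → toℕ (next (F.fromℕ m)) ≡ toℕ t
  lem (inj₁ (lt , _)) = ⊥-elim (ℕP.<-irrefl (FP.toℕ-fromℕ m) lt)
  lem (inj₂ (_ , e)) = trans e (sym et)
... | suc k = i , FP.toℕ-injective (lem (next-cases i))
  where
  k<m : k < m
  k<m = ℕP.≤-pred (subst (_< suc m) et (FP.toℕ<n t))
  i : Fin (suc m)
  i = F.fromℕ< (ℕP.m<n⇒m<1+n k<m)
  ti : toℕ i ≡ k
  ti = FP.toℕ-fromℕ< _
  lem : _ → toℕ (next i) ≡ toℕ t
  lem (inj₁ (_ , e)) = trans e (trans (cong suc ti) (sym et))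
  lem (inj₂ (e , _)) = ⊥-elim (ℕP.<-irrefl (trans (sym ti) e) k<m)

next-last : ∀ {m} (i : Fin (suc m)) → toℕ i ≡ m → next i ≡ F.zero
next-last i e with next-cases i
... | inj₁ (lt , _) = ⊥-elim (ℕP.<-irrefl e lt)
... | inj₂ (_ , z) = FP.toℕ-injective z

toℕ-next-< : ∀ {m} (i : Fin (suc m)) → toℕ i < m → toℕ (next i) ≡ suc (toℕ i)
toℕ-next-< i lt with next-cases i
... | inj₁ (_ , e) = e
... | inj₂ (e , _) = ⊥-elim (ℕP.<-irrefl e lt)

_∈?_ : ∀ {n} (i : Fin n) (xs : List (Fin n)) → Dec (i ∈ₗ xs)
i ∈? xs = Any.any? (i FP.≟_) xs

toSubset : ∀ {n} → List (Fin n) → Subset n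
toSubset xs = Vec.tabulate (λ i → ⌊ i ∈? xs ⌋)

lookup-toSubset : ∀ {n} (xs : List (Fin n)) i → lookup (toSubset xs) i ≡ ⌊ i ∈? xs ⌋
lookup-toSubset xs i = VP.lookup∘tabulate (λ i → ⌊ i ∈? xs ⌋) i

∈toSubset⁻ : ∀ {n} {xs : List (Fin n)} {i} → i ∈ toSubset xs → i ∈ₗ xs
∈toSubset⁻ {xs = xs} {i} m = toWitness (Equivalence.from BP.T-≡ (trans (sym (lookup-toSubset xs i)) (∈⇒lookup m)))

∈toSubset⁺ : ∀ {n} {xs : List (Fin n)} {i} → i ∈ₗ xs → i ∈ toSubset xs
∈toSubset⁺ {xs = xs} {i} m = lookup⇒∈ (trans (lookup-toSubset xs i) (Equivalence.to BP.T-≡ (fromWitness m)))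

-- Walks and cycles

Joins-sym : ∀ {N} {e : Pair N} {a b} → Joins e a b → Joins e b a
Joins-sym (inj₁ (p , q)) = inj₂ (p , q)
Joins-sym (inj₂ (p , q)) = inj₁ (p , q)

module Walks {N : ℕ} (E : List (Pair N)) where
  Ix : Set
  Ix = Fin (length E)
  ed : Ix → Pair N
  ed = List.lookup E

  data Walk : Fin N → Fin N → Set where
    []  : ∀ {a} → Walk a a
    step : ∀ {a b c} (x : Ix) → Joins (ed x) a b → Walk b c → Walk a c

  edges : ∀ {a b} → Walk a b → List Ix
  edges [] = []
  edges (step x _ w) = x ∷ edges w

  verts : ∀ {a b} → Walk a b → List (Fin N)
  verts [] = []
  verts (step {b = b} x _ w) = b ∷ verts w

  allv : ∀ {a b} → Walk a b → List (Fin N)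
  allv {a} w = a ∷ verts w

  _++w_ : ∀ {a b c} → Walk a b → Walk b c → Walk a c
  [] ++w w' = w'
  step x j w ++w w' = step x j (w ++w w')

  edges-++ : ∀ {a b c} (w : Walk a b) (w' : Walk b c) → edges (w ++w w') ≡ edges w ++ edges w'
  edges-++ [] w' = refl
  edges-++ (step x j w) w' = cong (x ∷_) (edges-++ w w')

  verts-++ : ∀ {a b c} (w : Walk a b) (w' : Walk b c) → verts (w ++w w') ≡ verts w ++ verts w'
  verts-++ [] w' = refl
  verts-++ (step x j w) w' = cong (_ ∷_) (verts-++ w w')

  rev : ∀ {a b} → Walk a b → Walk b a
  rev [] = []
  rev (step x j w) = rev w ++w step x (Joins-sym j) []

  edges-rev : ∀ {a b} (w : Walk a b) → edges (rev w) ≡ List.reverse (edges w)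
  edges-rev [] = refl
  edges-rev (step x j w) = trans (edges-++ (rev w) _) (trans (cong (_++ [ x ]) (edges-rev w)) (sym (LP.unfold-reverse x (edges w))))

  allv-rev : ∀ {a b} (w : Walk a b) → allv (rev w) ≡ List.reverse (allv w)
  allv-rev [] = refl
  allv-rev {a} (step x j w) = trans (cong (_ ∷_) (verts-++ (rev w) _))
    (trans (cong (_++ [ a ]) (allv-rev w)) (sym (LP.unfold-reverse a (allv w))))

  Simple : ∀ {a b} → Walk a b → Set
  Simple w = Unique (verts w) × Unique (edges w) × 2 ≤ length (edges w)

  record SplitAtEdge {a b} (w : Walk a b) (x : Ix) : Set where
    constructor mkSE
    field
      {p q} : Fin N
      j : Joins (ed x) p q
      w₁ : Walk a p
      w₂ : Walk q b
      eE : edges w ≡ edges w₁ ++ x ∷ edges w₂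
      eV : verts w ≡ verts w₁ ++ q ∷ verts w₂

  split-at-edge : ∀ {a b x} (w : Walk a b) → x ∈ₗ edges w → SplitAtEdge w x
  split-at-edge (step x j w) (here refl) = mkSE j [] w refl refl
  split-at-edge (step y j w) (there m) with split-at-edge w m
  ... | mkSE j' w₁ w₂ eE eV = mkSE j' (step y j w₁) w₂ (cong (y ∷_) eE) (cong (_ ∷_) eV)

  record SplitAtVertex {a b} (w : Walk a b) (z : Fin N) : Set where
    constructor mkSV
    field
      {p} : Fin N
      x : Ix
      j : Joins (ed x) p z
      w₁ : Walk a p
      w₂ : Walk z b
      eE : edges w ≡ edges w₁ ++ x ∷ edges w₂
      eV : verts w ≡ verts w₁ ++ z ∷ verts w₂

  split-at-vertex : ∀ {a b z} (w : Walk a b) → z ∈ₗ verts w → SplitAtVertex w z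
  split-at-vertex (step x j w) (here refl) = mkSV x j [] w refl refl
  split-at-vertex (step y j w) (there m) with split-at-vertex w m
  ... | mkSV x j' w₁ w₂ eE eV = mkSV x j' (step y j w₁) w₂ (cong (y ∷_) eE) (cong (_ ∷_) eV)

  record RotationToEdge {v} (w : Walk v v) (x : Ix) : Set where
    constructor mkRE
    field
      {p q} : Fin N
      j : Joins (ed x) p q
      w₂ : Walk q p
      pE : edges (step x j w₂) ↭ edges w
      pV : verts (step x j w₂) ↭ verts w

  rotate-to-edge : ∀ {v x} (w : Walk v v) → x ∈ₗ edges w → RotationToEdge w x
  rotate-to-edge {x = x} w m with split-at-edge w m
  ... | mkSE {q = q} j w₁ w₂ eE eV = mkRE j (w₂ ++w w₁)
      (subst₂ _↭_ (cong (x ∷_) (sym (edges-++ w₂ w₁))) (sym eE) (PP.++-comm (x ∷ edges w₂) (edges w₁)))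
      (subst₂ _↭_ (cong (q ∷_) (sym (verts-++ w₂ w₁))) (sym eV) (PP.++-comm (q ∷ verts w₂) (verts w₁)))

  record RotationToVertex {v} (w : Walk v v) (z : Fin N) : Set where
    constructor mkRV
    field
      w' : Walk z z
      pE : edges w' ↭ edges w
      pV : verts w' ↭ verts w

  rotate-to-vertex : ∀ {v z} (w : Walk v v) → z ∈ₗ verts w → RotationToVertex w z
  rotate-to-vertex {z = z} w m with split-at-vertex w m
  ... | mkSV x j w₁ w₂ eE eV = mkRV (w₂ ++w (w₁ ++w step x j []))
      (subst₂ _↭_ (sym (trans (edges-++ w₂ _) (cong (edges w₂ ++_) (edges-++ w₁ _)))) (sym eE) (rotate-snoc-↭ (edges w₁) x (edges w₂)))
      (subst₂ _↭_ (sym (trans (verts-++ w₂ _) (cong (verts w₂ ++_) (verts-++ w₁ _)))) (sym eV) (rotate-snoc-↭ (verts w₁) z (verts w₂)))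

  Simple-resp-↭ : ∀ {a b c d} (w : Walk a b) (w' : Walk c d) → edges w ↭ edges w' → verts w ↭ verts w' → Simple w' → Simple w
  Simple-resp-↭ w w' pE pV (uv , ue , l) = Unique-resp-↭ (↭-sym pV) uv , Unique-resp-↭ (↭-sym pE) ue , subst (2 ≤_) (sym (PP.↭-length pE)) l

  last∈verts : ∀ {a b} (w : Walk a b) → 1 ≤ length (edges w) → b ∈ₗ verts w
  last∈verts (step x j []) _ = here refl
  last∈verts (step x j (step y j' w)) _ = there (last∈verts (step y j' w) (s≤s z≤n))

  record LastStep {a c} (R : Walk a c) : Set where
    constructor mkLS
    field
      {b} : Fin N
      x : Ix
      j : Joins (ed x) b c
      R0 : Walk a b
      eE : edges R ≡ edges R0 ++ [ x ]
      eV : verts R ≡ verts R0 ++ [ c ]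

  last-step : ∀ {a c} (R : Walk a c) → 1 ≤ length (edges R) → LastStep R
  last-step (step x j []) _ = mkLS x j [] refl refl
  last-step (step x j R@(step _ _ _)) _ with last-step R (s≤s z≤n)
  ... | mkLS y j' R0 eE eV = mkLS y j' (step x j R0) (cong (x ∷_) eE) (cong (_ ∷_) eV)

  end∈allv : ∀ {a b} (w : Walk a b) → b ∈ₗ allv w
  end∈allv [] = here refl
  end∈allv (step x j w) = there (end∈allv w)

module Cut {N : ℕ} (S : Subset N) where
  inS : Fin N → Bool
  inS = lookup S

  uncrossed⇒same-side : ∀ {e a b} → Joins e a b → crossesᵇ S e ≡ false → inS a ≡ inS b
  uncrossed⇒same-side {e1 , e2} (inj₁ (refl , refl)) c with inS e1 | inS e2
  ... | true | true = refl
  ... | false | false = refl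
  ... | true | false = ⊥-elim (true≢false c)
  ... | false | true = ⊥-elim (true≢false c)
  uncrossed⇒same-side {e1 , e2} (inj₂ (refl , refl)) c with inS e1 | inS e2
  ... | true | true = refl
  ... | false | false = refl
  ... | true | false = ⊥-elim (true≢false c)
  ... | false | true = ⊥-elim (true≢false c)

  crossed⇒opposite-side : ∀ {e a b} → Joins e a b → crossesᵇ S e ≡ true → inS b ≡ not (inS a)
  crossed⇒opposite-side {e1 , e2} (inj₁ (refl , refl)) c with inS e1 | inS e2
  ... | true | true = ⊥-elim (true≢false (sym c))
  ... | false | false = ⊥-elim (true≢false (sym c))
  ... | true | false = refl
  ... | false | true = refl
  crossed⇒opposite-side {e1 , e2} (inj₂ (refl , refl)) c with inS e1 | inS e2
  ... | true | true = ⊥-elim (true≢false (sym c))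
  ... | false | false = ⊥-elim (true≢false (sym c))
  ... | true | false = refl
  ... | false | true = refl

  both-ends-side : ∀ {e a b s} → Joins e a b → inS a ≡ s → inS b ≡ s → inS (proj₁ e) ≡ s × inS (proj₂ e) ≡ s
  both-ends-side (inj₁ (refl , refl)) p q = p , q
  both-ends-side (inj₂ (refl , refl)) p q = q , p

module CutWalks {N : ℕ} (E : List (Pair N)) (S : Subset N) where
  open Walks E public
  open Cut S public

  crossingᵇ : Ix → Bool
  crossingᵇ x = crossesᵇ S (ed x)

  Uncrossing : ∀ {a b} → Walk a b → Set
  Uncrossing w = All (λ x → crossingᵇ x ≡ false) (edges w)

  uncrossing-allv : ∀ {a b} (w : Walk a b) → Uncrossing w → All (λ z → inS z ≡ inS a) (allv w)
  uncrossing-allv [] _ = refl ∷ []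
  uncrossing-allv (step x j w) (c ∷ nc) = refl ∷ All.map (λ e → trans e (sym (uncrossed⇒same-side j c))) (uncrossing-allv w nc)

  uncrossing-end : ∀ {a b} (w : Walk a b) → Uncrossing w → inS b ≡ inS a
  uncrossing-end [] _ = refl
  uncrossing-end (step x j w) (c ∷ nc) = trans (uncrossing-end w nc) (sym (uncrossed⇒same-side j c))

  uncrossing-edges : ∀ {a b} (w : Walk a b) → Uncrossing w → All (λ x → inS (proj₁ (ed x)) ≡ inS a × inS (proj₂ (ed x)) ≡ inS a) (edges w)
  uncrossing-edges [] _ = []
  uncrossing-edges (step x j w) (c ∷ nc) = both-ends-side j refl (sym (uncrossed⇒same-side j c)) ∷
    All.map (λ { (p , q) → trans p (sym (uncrossed⇒same-side j c)) , trans q (sym (uncrossed⇒same-side j c)) }) (uncrossing-edges w nc)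

  record FirstCrossing {a b} (w : Walk a b) : Set where
    constructor mkFC
    field
      {p q} : Fin N
      P : Walk a p
      y : Ix
      j : Joins (ed y) p q
      cy : crossingᵇ y ≡ true
      Q : Walk q b
      ncP : Uncrossing P
      eE : edges w ≡ edges P ++ y ∷ edges Q
      eV : verts w ≡ verts P ++ q ∷ verts Q

  firstCrossing : ∀ {a b} (w : Walk a b) → inS a ≢ inS b → FirstCrossing w
  firstCrossing [] ne = ⊥-elim (ne refl)
  firstCrossing (step x j w) ne with true-or-false (crossingᵇ x)
  ... | inj₁ t = mkFC [] x j t w [] refl refl
  ... | inj₂ f with firstCrossing w (λ e → ne (trans (uncrossed⇒same-side j f) e))
  ...   | mkFC P y j' cy Q ncP eE eV = mkFC (step x j P) y j' cy Q (f ∷ ncP) (cong (x ∷_) eE) (cong (_ ∷_) eV)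

  -- A cycle entering S by x (from a ∉ S to b ∈ S), running inside S along P, leaving S by y
  -- and closing up outside S along Q; every edge of es0 occurs in it.
  record CrossingCycle (es0 : List Ix) : Set where
    constructor mkC
    field
      {a b b' a'} : Fin N
      x y : Ix
      jx : Joins (ed x) a b
      P : Walk b b'
      jy : Joins (ed y) b' a'
      Q : Walk a' a
      sda : inS a ≡ false
      sdb : inS b ≡ true
      ncP : Uncrossing P
      ncQ : Uncrossing Q
      crx : crossingᵇ x ≡ true
      cry : crossingᵇ y ≡ true
      uv : Unique (b ∷ verts P ++ a' ∷ verts Q)
      ue : Unique (x ∷ edges P ++ y ∷ edges Q)
      covers : ∀ {z} → z ∈ₗ es0 → z ∈ₗ (x ∷ edges P ++ y ∷ edges Q)

  module _ (crossing≤2 : ∀ xs → Unique xs → All (λ x → crossingᵇ x ≡ true) xs → length xs ≤ 2) where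
    crossing-cycle-shape : ∀ {v x0} (w : Walk v v) → Simple w → x0 ∈ₗ edges w → crossingᵇ x0 ≡ true → CrossingCycle (edges w)
    crossing-cycle-shape {x0 = x0} w gw m c0 with rotate-to-edge w m
    ... | mkRE {p} {q} j w₂ pE pV with Simple-resp-↭ (step x0 j w₂) w pE pV gw | firstCrossing w₂ (λ e → BP.not-¬ refl (trans (sym e) (crossed⇒opposite-side j c0)))
    ...   | (uv0 , ue0 , _) | mkFC {p'} {q'} P y jy cy Q ncP eE eV = result
      where
      VL = q ∷ verts P ++ q' ∷ verts Q
      EL = x0 ∷ edges P ++ y ∷ edges Q
      uvL : Unique VL
      uvL = subst (λ l → Unique (q ∷ l)) eV uv0
      ueL : Unique EL
      ueL = subst (λ l → Unique (x0 ∷ l)) eE ue0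
      fromW : ∀ {z} → z ∈ₗ edges w → z ∈ₗ EL
      fromW m' = subst (λ l → _ ∈ₗ x0 ∷ l) eE (PP.∈-resp-↭ (↭-sym pE) m')
      ncQ : Uncrossing Q
      ncQ = All.tabulate λ {z} mz → helper z mz (true-or-false (crossingᵇ z))
        where
        helper : ∀ z → z ∈ₗ edges Q → crossingᵇ z ≡ true ⊎ crossingᵇ z ≡ false → crossingᵇ z ≡ false
        helper z mz (inj₂ f) = f
        helper z mz (inj₁ t) = ⊥-elim (3≰2 (crossing≤2 (x0 ∷ y ∷ z ∷ []) u3 (c0 ∷ cy ∷ t ∷ [])))
          where
          u' : Unique (y ∷ edges Q)
          u' = proj₁ (proj₂ (Unique-++⁻ (edges P) (Unique-tail ueL)))
          u3 : Unique (x0 ∷ y ∷ z ∷ [])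
          u3 = (head∉tail ueL (MP.∈-++⁺ʳ (edges P) (here refl)) ∷ head∉tail ueL (MP.∈-++⁺ʳ (edges P) (there mz)) ∷ [])
             ∷ ((head∉tail u' mz ∷ []) ∷ ([] ∷ []))
      result : CrossingCycle (edges w)
      result with true-or-false (inS p)
      ... | inj₂ fp = mkC x0 y j P jy Q fp (trans (crossed⇒opposite-side j c0) (cong not fp)) ncP ncQ c0 cy uvL ueL fromW
      ... | inj₁ tp = mkC y x0 jy Q j P sdp' sdq' ncQ ncP cy c0
            (Unique-resp-↭ (PP.++-comm (q ∷ verts P) (q' ∷ verts Q)) uvL)
            (Unique-resp-↭ (PP.++-comm (x0 ∷ edges P) (y ∷ edges Q)) ueL)
            (λ m' → PP.∈-resp-↭ (PP.++-comm (x0 ∷ edges P) (y ∷ edges Q)) (fromW m'))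
        where
        sdq : inS q ≡ false
        sdq = trans (crossed⇒opposite-side j c0) (cong not tp)
        sdp' : inS p' ≡ false
        sdp' = trans (uncrossing-end P ncP) sdq
        sdq' : inS q' ≡ true
        sdq' = trans (crossed⇒opposite-side jy cy) (cong not sdp')

module CyclesAsWalks {N : ℕ} (I : Instance N) where
  open Walks (E I)

  -- IsCycle I K holds exactly when K is the edge set of a closed walk with no repeated vertex or
  -- edge and at least two edges.
  record CycleWalk (K : Subset (length (E I))) : Set where
    constructor mkCW
    field
      {v} : Fin N
      w : Walk v v
      simple : Simple w
      K→ : ∀ {x} → x ∈ K → x ∈ₗ edges w
      →K : ∀ {x} → x ∈ₗ edges w → x ∈ K

  module Unroll (j : ℕ) (vs : Fin (suc (suc j)) → Fin N) (es : Fin (suc (suc j)) → Ix)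
            (J : ∀ i → Joins (ed (es i)) (vs i) (vs (next i))) where
    n = suc (suc j)
    orbit : ℕ → Fin n → List (Fin n)
    orbit zero i = []
    orbit (suc d) i = next i ∷ orbit d (next i)

    <-of-bound : ∀ {i : Fin n} d → toℕ i + suc d ≤ suc j → toℕ i < suc j
    <-of-bound {i} d h = ℕP.<-≤-trans (ℕP.m<m+n (toℕ i) (s≤s z≤n)) h

    walk-from : (d : ℕ) (i : Fin n) → toℕ i + d ≡ suc j → Walk (vs i) (vs F.zero)
    walk-from zero i eq = step (es i) (subst (λ z → Joins (ed (es i)) (vs i) (vs z)) (next-last i (trans (sym (ℕP.+-identityʳ _)) eq)) (J i)) []
    walk-from (suc d) i eq = step (es i) (J i) (walk-from d (next i) eq2)
      where
      eq2 : toℕ (next i) + d ≡ suc j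
      eq2 = trans (cong (_+ d) (toℕ-next-< i (<-of-bound d (ℕP.≤-reflexive eq)))) (trans (sym (ℕP.+-suc (toℕ i) d)) eq)

    edges-walk-from : ∀ d i eq → edges (walk-from d i eq) ≡ es i ∷ map es (orbit d i)
    edges-walk-from zero i eq = refl
    edges-walk-from (suc d) i eq = cong (es i ∷_) (edges-walk-from d (next i) _)

    verts-walk-from : ∀ d i eq → verts (walk-from d i eq) ≡ map vs (orbit d i) ++ [ vs F.zero ]
    verts-walk-from zero i eq = refl
    verts-walk-from (suc d) i eq = cong (vs (next i) ∷_) (verts-walk-from d (next i) _)

    length-orbit : ∀ d i → length (orbit d i) ≡ d
    length-orbit zero i = refl
    length-orbit (suc d) i = cong suc (length-orbit d (next i))

    orbit-increasing : ∀ d i → toℕ i + d ≤ suc j → All (λ z → toℕ i < toℕ z) (orbit d i)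
    orbit-increasing zero i _ = []
    orbit-increasing (suc d) i h = ℕP.≤-reflexive (sym e) ∷ All.map (ℕP.<-trans (ℕP.≤-reflexive (sym e))) (orbit-increasing d (next i) h')
      where
      e = toℕ-next-< i (<-of-bound d h)
      h' : toℕ (next i) + d ≤ suc j
      h' = subst (_≤ suc j) (trans (ℕP.+-suc (toℕ i) d) (cong (_+ d) (sym e))) h

    Unique-orbit : ∀ d i → toℕ i + d ≤ suc j → Unique (i ∷ orbit d i)
    Unique-orbit zero i _ = [] ∷ []
    Unique-orbit (suc d) i h = All.map (λ lt eq → ℕP.<-irrefl (cong toℕ eq) lt) (orbit-increasing (suc d) i h) ∷ Unique-orbit d (next i) h'
      where
      e = toℕ-next-< i (<-of-bound d h)
      h' : toℕ (next i) + d ≤ suc j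
      h' = subst (_≤ suc j) (trans (ℕP.+-suc (toℕ i) d) (cong (_+ d) (sym e))) h

    ∈-orbit : ∀ d i t → toℕ i ≤ toℕ t → toℕ t ≤ toℕ i + d → toℕ i + d ≤ suc j → t ∈ₗ (i ∷ orbit d i)
    ∈-orbit d i t h1 h2 h3 with ℕP.m≤n⇒m<n∨m≡n h1
    ... | inj₂ eq = here (FP.toℕ-injective (sym eq))
    ∈-orbit zero i t h1 h2 h3 | inj₁ lt = ⊥-elim (ℕP.<-irrefl refl (ℕP.<-≤-trans lt (subst (toℕ t ≤_) (ℕP.+-identityʳ _) h2)))
    ∈-orbit (suc d) i t h1 h2 h3 | inj₁ lt = there (∈-orbit d (next i) t
        (subst (_≤ toℕ t) (sym e) lt)
        (subst (toℕ t ≤_) (trans (ℕP.+-suc (toℕ i) d) (cong (_+ d) (sym e))) h2)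
        (subst (_≤ suc j) (trans (ℕP.+-suc (toℕ i) d) (cong (_+ d) (sym e))) h3))
      where
      e = toℕ-next-< i (<-of-bound d h3)

    closedWalk : Walk (vs F.zero) (vs F.zero)
    closedWalk = walk-from (suc j) F.zero refl

    orbit-complete : ∀ t → t ∈ₗ (F.zero ∷ orbit (suc j) F.zero)
    orbit-complete t = ∈-orbit (suc j) F.zero t z≤n (FP.toℕ≤pred[n] t) ℕP.≤-refl

  IsCycle⇒walk : ∀ {K} → IsCycle I K → CycleWalk K
  IsCycle⇒walk {K} (j , vs , es , vinj , einj , J , Kiff) = mkCW closedWalk (uv , ue , len) K→' →K'
    where
    open Unroll j vs es J
    uv : Unique (verts closedWalk)
    uv = subst Unique (sym (verts-walk-from (suc j) F.zero refl))
      (Unique-resp-↭ (PP.++-comm [ vs F.zero ] (map vs (orbit (suc j) F.zero)))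
        (UP.map⁺ vinj (Unique-orbit (suc j) F.zero ℕP.≤-refl)))
    ue : Unique (edges closedWalk)
    ue = subst Unique (sym (edges-walk-from (suc j) F.zero refl)) (UP.map⁺ einj (Unique-orbit (suc j) F.zero ℕP.≤-refl))
    len : 2 ≤ length (edges closedWalk)
    len = subst (2 ≤_) (sym (trans (cong length (edges-walk-from (suc j) F.zero refl)) (cong suc (trans (LP.length-map es (orbit (suc j) F.zero)) (length-orbit (suc j) F.zero))))) (s≤s (s≤s z≤n))
    K→' : ∀ {x} → x ∈ K → x ∈ₗ edges closedWalk
    K→' {x} m with Equivalence.to (Kiff x) m
    ... | i , refl rewrite edges-walk-from (suc j) F.zero refl = MP.∈-map⁺ es (orbit-complete i)
    →K' : ∀ {x} → x ∈ₗ edges closedWalk → x ∈ K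
    →K' {x} m with MP.∈-map⁻ es (subst (x ∈ₗ_) (edges-walk-from (suc j) F.zero refl) m)
    ... | i , _ , refl = Equivalence.from (Kiff x) (i , refl)

  target : ∀ {a b} (w : Walk a b) → Fin (length (edges w)) → Fin N
  target (step {b = b} x j w) F.zero = b
  target (step x j w) (F.suc k) = target w k

  source : ∀ {a b} (w : Walk a b) → Fin (length (edges w)) → Fin N
  source (step {a = a} x j w) F.zero = a
  source (step x j w) (F.suc k) = source w k

  edge-at : ∀ {a b} (w : Walk a b) → Fin (length (edges w)) → Ix
  edge-at w = List.lookup (edges w)

  joins-at : ∀ {a b} (w : Walk a b) k → Joins (ed (edge-at w k)) (source w k) (target w k)
  joins-at (step x j w) F.zero = j
  joins-at (step x j w) (F.suc k) = joins-at w k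

  source-first : ∀ {a b} (w : Walk a b) k → toℕ k ≡ 0 → source w k ≡ a
  source-first (step x j w) F.zero _ = refl

  source-next : ∀ {a b} (w : Walk a b) k k' → toℕ k' ≡ suc (toℕ k) → source w k' ≡ target w k
  source-next (step x j w) F.zero (F.suc k') e = source-first w k' (ℕP.suc-injective e)
  source-next (step x j w) (F.suc k) (F.suc k') e = source-next w k k' (ℕP.suc-injective e)

  target-last : ∀ {a b} (w : Walk a b) k → suc (toℕ k) ≡ length (edges w) → target w k ≡ b
  target-last (step x j []) F.zero _ = refl
  target-last (step x j (step _ _ _)) F.zero ()
  target-last (step x j w) (F.suc k) e = target-last w k (ℕP.suc-injective e)

  target∈verts : ∀ {a b} (w : Walk a b) k → target w k ∈ₗ verts w
  target∈verts (step x j w) F.zero = here refl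
  target∈verts (step x j w) (F.suc k) = there (target∈verts w k)

  target-injective : ∀ {a b} (w : Walk a b) → Unique (verts w) → ∀ {k k'} → target w k ≡ target w k' → k ≡ k'
  target-injective (step x j w) u {F.zero} {F.zero} e = refl
  target-injective (step x j w) u {F.zero} {F.suc k'} e = ⊥-elim (head∉tail u (target∈verts w k') e)
  target-injective (step x j w) u {F.suc k} {F.zero} e = ⊥-elim (head∉tail u (target∈verts w k) (sym e))
  target-injective (step x j w) (_ ∷ u) {F.suc k} {F.suc k'} e = cong F.suc (target-injective w u e)

  Simple⇒IsCycle : ∀ {v} (w : Walk v v) → Simple w → IsCycle I (toSubset (edges w))
  Simple⇒IsCycle {v} w (uv , ue , len) = jj , vs , es , vinj , einj , J , Kiff
    where
    n = length (edges w)
    jj = n ∸ 2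
    ce : suc (suc jj) ≡ n
    ce = trans (ℕP.+-comm 2 jj) (ℕP.m∸n+n≡m len)
    cst : Fin (suc (suc jj)) → Fin n
    cst = F.cast ce
    tc : ∀ k → toℕ (cst k) ≡ toℕ k
    tc k = FP.toℕ-cast ce k
    cst-inj : ∀ {k k'} → cst k ≡ cst k' → k ≡ k'
    cst-inj {k} {k'} e = FP.toℕ-injective (trans (sym (tc k)) (trans (cong toℕ e) (tc k')))
    -- vs k is where the k-th step ends, so the edge from vs k to vs (next k) is the step after it.
    vs : Fin (suc (suc jj)) → Fin N
    vs k = target w (cst k)
    es : Fin (suc (suc jj)) → Ix
    es k = edge-at w (cst (next k))
    vinj : Injective _≡_ _≡_ vs
    vinj e = cst-inj (target-injective w uv e)
    einj : Injective _≡_ _≡_ es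
    einj e = next-injective (cst-inj (Unique⇒lookup-injective ue e))
    link : ∀ k → source w (cst (next k)) ≡ target w (cst k)
    link k with next-cases k
    ... | inj₁ (_ , e) = source-next w (cst k) (cst (next k)) (trans (tc (next k)) (trans e (cong suc (sym (tc k)))))
    ... | inj₂ (e1 , e2) = trans (source-first w _ (trans (tc (next k)) e2)) (sym (target-last w (cst k) (trans (cong suc (trans (tc k) e1)) ce)))
    J : ∀ k → Joins (ed (es k)) (vs k) (vs (next k))
    J k = subst (λ z → Joins (ed (es k)) z (vs (next k))) (link k) (joins-at w (cst (next k)))
    Kiff : ∀ x → (x ∈ toSubset (edges w)) ⇔ (∃ λ i → es i ≡ x)
    Kiff x = mk⇔ to from
      where
      to : x ∈ toSubset (edges w) → ∃ λ i → es i ≡ x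
      to m with Any.index (∈toSubset⁻ m) | AnyP.lookup-index (∈toSubset⁻ m)
      ... | k | e with next-surjective (F.cast (sym ce) k)
      ...   | i , ei = i , trans (cong (edge-at w) cc) (sym e)
        where
        cc : cst (next i) ≡ k
        cc = FP.toℕ-injective (trans (tc (next i)) (trans (cong toℕ ei) (FP.toℕ-cast (sym ce) k)))
      from : (∃ λ i → es i ≡ x) → x ∈ toSubset (edges w)
      from (i , refl) = ∈toSubset⁺ (MP.∈-lookup (cst (next i)))

-- Contraction

module Contraction {N : ℕ} (I : Instance N) (S : Subset N) (r : Fin N) (r∈S : lookup S r ≡ true) where
  inS : Fin N → Bool
  inS = lookup S
  red : Fin N → Fin N
  red = redirect S r
  keptᵇ : Pair N → Bool
  keptᵇ e = not (bothInᵇ S e)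
  redirectPair : Pair N → Pair N
  redirectPair e = red (proj₁ e) , red (proj₂ e)
  I' : Instance N
  I' = contract I S r
  V' : Subset N
  V' = V I'

  red-inside : ∀ {x} → inS x ≡ true → red x ≡ r
  red-inside e rewrite e = refl
  red-outside : ∀ {x} → inS x ≡ false → red x ≡ x
  red-outside e rewrite e = refl

  inside≢outside : ∀ {x y} → inS x ≡ true → inS y ≡ false → x ≢ y
  inside≢outside ex ey refl = true≢false (trans (sym ex) ey)

  r≢outside : ∀ {x} → inS x ≡ false → r ≢ x
  r≢outside = inside≢outside r∈S

  red≡r⇒inside : ∀ {x} → red x ≡ r → inS x ≡ true
  red≡r⇒inside {x} e with true-or-false (inS x)
  ... | inj₁ t = t
  ... | inj₂ f = ⊥-elim (r≢outside f (sym (trans (sym (red-outside f)) e)))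

  ∈V'⁻ : ∀ {x} → lookup V' x ≡ true → (lookup (V I) x ≡ true × inS x ≡ false) ⊎ x ≡ r
  ∈V'⁻ {x} e rewrite lookup-∪ (V I ─ S) ⁅ r ⁆ x | lookup-─ (V I) S x with true-or-false (lookup (V I) x) | true-or-false (inS x)
  ... | inj₁ a | inj₂ b = inj₁ (a , b)
  ... | inj₁ a | inj₁ b rewrite a | b = inj₂ (SP.x∈⁅y⁆⇒x≡y r (lookup⇒∈ e))
  ... | inj₂ a | _ rewrite a = inj₂ (SP.x∈⁅y⁆⇒x≡y r (lookup⇒∈ e))

  ∈V'⁺ : ∀ {x} → (lookup (V I) x ≡ true × inS x ≡ false) ⊎ x ≡ r → lookup V' x ≡ true
  ∈V'⁺ {x} h rewrite lookup-∪ (V I ─ S) ⁅ r ⁆ x | lookup-─ (V I) S x with h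
  ... | inj₁ (a , b) rewrite a | b = refl
  ... | inj₂ refl rewrite ∈⇒lookup (SP.x∈⁅x⁆ r) = BP.∨-zeroʳ _

  red-=ᵥ-outside : ∀ {v} a → inS v ≡ false → (red a =ᵥ v) ≡ (a =ᵥ v)
  red-=ᵥ-outside {v} a hv with true-or-false (inS a)
  ... | inj₁ t rewrite red-inside t | ≢⇒=ᵥ-false (r≢outside hv) | ≢⇒=ᵥ-false (inside≢outside t hv) = refl
  ... | inj₂ f rewrite red-outside f = refl

  red-=ᵥ-r : ∀ a → (red a =ᵥ r) ≡ inS a
  red-=ᵥ-r a with true-or-false (inS a)
  ... | inj₁ t rewrite red-inside t | t = =ᵥ-refl r
  ... | inj₂ f rewrite red-outside f | f = ≢⇒=ᵥ-false (λ e → r≢outside f (sym e))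

  incidentᵇ-redirect-outside : ∀ {v} → inS v ≡ false → ∀ e → (keptᵇ e ∧ incidentᵇ v (redirectPair e)) ≡ incidentᵇ v e
  incidentᵇ-redirect-outside hv (a , b) rewrite red-=ᵥ-outside a hv | red-=ᵥ-outside b hv
    with true-or-false (inS a) | true-or-false (inS b)
  ... | inj₁ ta | inj₁ tb rewrite ta | tb | ≢⇒=ᵥ-false (inside≢outside ta hv) | ≢⇒=ᵥ-false (inside≢outside tb hv) = refl
  ... | inj₁ ta | inj₂ fb rewrite ta | fb = refl
  ... | inj₂ fa | _ rewrite fa = refl

  deg-outside : ∀ {v} → inS v ≡ false → deg I' v ≡ deg I v
  deg-outside {v} hv =
    length-filter-map-filter (incidentᵇ v) redirectPair keptᵇ (incidentᵇ v) (incidentᵇ-redirect-outside hv) (E I)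

  deg-r≡|δE| : deg I' r ≡ length (δE I S)
  deg-r≡|δE| = length-filter-map-filter (incidentᵇ r) redirectPair keptᵇ (crossesᵇ S) pw (E I)
    where
    pw : ∀ e → (keptᵇ e ∧ incidentᵇ r (redirectPair e)) ≡ crossesᵇ S e
    pw (a , b) rewrite red-=ᵥ-r a | red-=ᵥ-r b with inS a | inS b
    ... | true | true = refl
    ... | true | false = refl
    ... | false | true = refl
    ... | false | false = refl

  endpointᵇ-outside : ∀ {v} → inS v ≡ false → endpointᵇ I' v ≡ endpointᵇ I v
  endpointᵇ-outside {v} hv = any-map-filter (incidentᵇ v) redirectPair keptᵇ (incidentᵇ v) (incidentᵇ-redirect-outside hv) (L I)

  red-∈V' : ∀ {x} → lookup (V I) x ≡ true → lookup V' (red x) ≡ true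
  red-∈V' {x} hx with true-or-false (inS x)
  ... | inj₁ t rewrite red-inside t = ∈V'⁺ (inj₂ refl)
  ... | inj₂ f rewrite red-outside f = ∈V'⁺ (inj₁ (hx , f))

  contractList-InBinom : ∀ xs → (∀ e → e ∈ₗ xs → InBinom (V I) e) → ∀ e → e ∈ₗ contractList S r xs → InBinom V' e
  contractList-InBinom xs h e m with MP.∈-map⁻ redirectPair m
  ... | (a , b) , m0 , refl with ∈-filterᵇ⁻ keptᵇ xs m0
  ... | m1 , q1 with h (a , b) m1
  ... | aV , bV , a≢b = lookup⇒∈ (red-∈V' (∈⇒lookup aV)) , lookup⇒∈ (red-∈V' (∈⇒lookup bV)) , ne
    where
    ne : red a ≢ red b
    ne eq with true-or-false (inS a) | true-or-false (inS b)
    ... | inj₁ ta | inj₁ tb rewrite ta | tb = true≢false (sym q1)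
    ... | inj₁ ta | inj₂ fb rewrite red-inside ta | red-outside fb = r≢outside fb eq
    ... | inj₂ fa | inj₁ tb rewrite red-outside fa | red-inside tb = r≢outside fa (sym eq)
    ... | inj₂ fa | inj₂ fb rewrite red-outside fa | red-outside fb = a≢b eq

  Joins-redirect : ∀ {e a b} → Joins e a b → Joins (redirectPair e) (red a) (red b)
  Joins-redirect (inj₁ (refl , refl)) = inj₁ (refl , refl)
  Joins-redirect (inj₂ (refl , refl)) = inj₂ (refl , refl)

  Adj-contract : ∀ {a b} → Adj (E I) a b → red a ≡ red b ⊎ Adj (E I') (red a) (red b)
  Adj-contract {a} {b} (e , m , j) with true-or-false (keptᵇ e)
  ... | inj₁ q = inj₂ (redirectPair e , MP.∈-map⁺ redirectPair (∈-filterᵇ⁺ keptᵇ m q) , Joins-redirect j)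
  ... | inj₂ q = inj₁ (trans (red-inside (ina j)) (sym (red-inside (inb j))))
    where
    both : inS (proj₁ e) ≡ true × inS (proj₂ e) ≡ true
    both with inS (proj₁ e) | inS (proj₂ e)
    ... | true | true = refl , refl
    ... | true | false = ⊥-elim (true≢false q)
    ... | false | _ = ⊥-elim (true≢false q)
    ina : Joins e a b → inS a ≡ true
    ina (inj₁ (refl , refl)) = proj₁ both
    ina (inj₂ (refl , refl)) = proj₂ both
    inb : Joins e a b → inS b ≡ true
    inb (inj₁ (refl , refl)) = proj₂ both
    inb (inj₂ (refl , refl)) = proj₁ both

  Star-contract : ∀ {a b} → Star (Adj (E I)) a b → Star (Adj (E I')) (red a) (red b)
  Star-contract ε = ε
  Star-contract {a} {b} (_◅_ {j = c} s rest) with Adj-contract s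
  ... | inj₁ eq = subst (λ z → Star (Adj (E I')) z (red b)) (sym eq) (Star-contract rest)
  ... | inj₂ adj = adj ◅ Star-contract rest

  red-fixes-V' : ∀ {x} → lookup V' x ≡ true → red x ≡ x
  red-fixes-V' h with ∈V'⁻ h
  ... | inj₁ (_ , f) = red-outside f
  ... | inj₂ refl = red-inside r∈S

  module _ (S⊆V : S ⊆ V I) where
    contract-Connected : Connected I → Connected I'
    contract-Connected c x y hx hy = subst₂ (Star (Adj (E I'))) (red-fixes-V' (∈⇒lookup hx)) (red-fixes-V' (∈⇒lookup hy))
      (Star-contract (c x y (lookup⇒∈ (V'inV (∈⇒lookup hx))) (lookup⇒∈ (V'inV (∈⇒lookup hy)))))
      where
      V'inV : ∀ {z} → lookup V' z ≡ true → lookup (V I) z ≡ true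
      V'inV h with ∈V'⁻ h
      ... | inj₁ (a , _) = a
      ... | inj₂ refl = ∈⇒lookup (S⊆V (lookup⇒∈ r∈S))

module ContractCycles {N : ℕ} (I : Instance N) (S : Subset N) (r : Fin N) (r∈S : lookup S r ≡ true) where
  open Contraction I S r r∈S
  module G = CutWalks (E I) S
  module H = Walks (E I')
  open FilterMapIndex keptᵇ redirectPair

  -- φ x' is the position in E I of the edge that became the x'-th edge of the contraction.
  φ : H.Ix → G.Ix
  φ = origin (E I)

  lookup-φ : ∀ x' → H.ed x' ≡ redirectPair (G.ed (φ x'))
  lookup-φ x' = lookup-origin (E I) x'

  φ-inj : ∀ {i k} → φ i ≡ φ k → i ≡ k
  φ-inj = origin-injective (E I)

  ∈-map-φ⁻ : ∀ {y' L} → φ y' ∈ₗ map φ L → y' ∈ₗ L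
  ∈-map-φ⁻ m with MP.∈-map⁻ φ m
  ... | z , mz , e rewrite φ-inj e = mz

  both-inside⇒removed : ∀ {e} → inS (proj₁ e) ≡ true → inS (proj₂ e) ≡ true → keptᵇ e ≡ false
  both-inside⇒removed {e1 , e2} p q rewrite p | q = refl

  φ-not-inside : ∀ y' → inS (proj₁ (G.ed (φ y'))) ≡ true → inS (proj₂ (G.ed (φ y'))) ≡ true → ⊥
  φ-not-inside y' p q = true≢false (trans (sym (origin-kept (E I) y')) (both-inside⇒removed p q))

  red≢r⇒outside : ∀ {p a} → red p ≡ a → a ≢ r → inS p ≡ false × p ≡ a
  red≢r⇒outside {p} e ne with true-or-false (inS p)
  ... | inj₁ t = ⊥-elim (ne (trans (sym e) (red-inside t)))
  ... | inj₂ f = f , trans (sym (red-outside f)) e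

  lift-step : ∀ {x' a b} → Joins (H.ed x') a b → a ≢ r → b ≢ r →
             Joins (G.ed (φ x')) a b × inS a ≡ false × inS b ≡ false
  lift-step {x'} {a} {b} j na nb = on-pair (G.ed (φ x')) (subst (λ e → Joins e a b) (lookup-φ x') j)
    where
    on-pair : ∀ e → Joins (redirectPair e) a b → Joins e a b × inS a ≡ false × inS b ≡ false
    on-pair (p , q) (inj₁ (e1 , e2)) with red≢r⇒outside e1 na | red≢r⇒outside e2 nb
    ... | f1 , refl | f2 , refl = inj₁ (refl , refl) , f1 , f2
    on-pair (p , q) (inj₂ (e1 , e2)) with red≢r⇒outside e1 nb | red≢r⇒outside e2 na
    ... | f1 , refl | f2 , refl = inj₂ (refl , refl) , f2 , f1

  lift-step-to-r : ∀ {x' a} → Joins (H.ed x') a r → a ≢ r →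
              ∃ λ s → inS s ≡ true × Joins (G.ed (φ x')) a s × inS a ≡ false
  lift-step-to-r {x'} {a} j na = on-pair (G.ed (φ x')) (subst (λ e → Joins e a r) (lookup-φ x') j)
    where
    on-pair : ∀ e → Joins (redirectPair e) a r → ∃ λ s → inS s ≡ true × Joins e a s × inS a ≡ false
    on-pair (p , q) (inj₁ (e1 , e2)) with red≢r⇒outside e1 na
    ... | f1 , refl = q , red≡r⇒inside e2 , inj₁ (refl , refl) , f1
    on-pair (p , q) (inj₂ (e1 , e2)) with red≢r⇒outside e2 na
    ... | f2 , refl = p , red≡r⇒inside e1 , inj₂ (refl , refl) , f2

  map-step : ∀ {x a b} → Joins (G.ed x) a b → keptᵇ (G.ed x) ≡ true → ∃ λ x' → φ x' ≡ x × Joins (H.ed x') (red a) (red b)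
  map-step {x} j q with origin-surjective (E I) x q
  ... | x' , refl = x' , refl , subst (λ e → Joins e _ _) (sym (lookup-φ x')) (Joins-redirect j)

  outside-end⇒kept : ∀ {e a b} → Joins e a b → inS a ≡ false → keptᵇ e ≡ true
  outside-end⇒kept {e1 , e2} (inj₁ (refl , refl)) f rewrite f = refl
  outside-end⇒kept {e1 , e2} (inj₂ (refl , refl)) f rewrite f = cong not (BP.∧-zeroʳ (inS e1))

  map-walk : ∀ {a b} (w : G.Walk a b) → All (λ z → inS z ≡ false) (G.allv w) →
    Σ (H.Walk a b) λ w' → map φ (H.edges w') ≡ G.edges w × H.verts w' ≡ G.verts w
  map-walk G.[] _ = H.[] , refl , refl
  map-walk (G.step x j w) (fa ∷ all@(fb ∷ _)) with map-step j (outside-end⇒kept j fa) | map-walk w all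
  ... | x' , e , j' | w' , eE , eV =
    H.step x' (subst₂ (Joins (H.ed x')) (red-outside fa) (red-outside fb) j') w' , cong₂ _∷_ e eE , cong (_ ∷_) eV

  lift-walk : ∀ {a b} (w' : H.Walk a b) → All (λ z → z ≢ r) (H.allv w') →
    Σ (G.Walk a b) λ w → G.edges w ≡ map φ (H.edges w') × G.verts w ≡ H.verts w' × All (λ z → inS z ≡ false) (H.verts w')
  lift-walk H.[] _ = G.[] , refl , refl , []
  lift-walk (H.step x' j w') (na ∷ all@(nb ∷ _)) with lift-step j na nb | lift-walk w' all
  ... | jl , fa , fb | w , eE , eV , sides = G.step (φ x') jl w , cong (φ x' ∷_) eE , cong (_ ∷_) eV , fb ∷ sides

  find-crossing : ∀ xs → (∃ λ z → z ∈ₗ xs × G.crossingᵇ z ≡ true) ⊎ All (λ z → G.crossingᵇ z ≡ false) xs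
  find-crossing [] = inj₂ []
  find-crossing (x ∷ xs) with true-or-false (G.crossingᵇ x)
  ... | inj₁ t = inj₁ (x , here refl , t)
  ... | inj₂ f with find-crossing xs
  ...   | inj₁ (z , m , t) = inj₁ (z , there m , t)
  ...   | inj₂ a = inj₂ (f ∷ a)

  Unique-drop-middle : ∀ {A : Set} {x : A} (P Q : List A) → Unique (x ∷ P ++ Q) → Unique (x ∷ Q)
  Unique-drop-middle {x = x} P Q (a ∷ u) = AP.++⁻ʳ P a ∷ proj₁ (proj₂ (Unique-++⁻ P u))

  map-walk-Simple : ∀ {a} (w : G.Walk a a) (w' : H.Walk a a) → map φ (H.edges w') ≡ G.edges w → H.verts w' ≡ G.verts w →
            G.Simple w → H.Simple w'
  map-walk-Simple w w' eE eV (uv , ue , len) =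
    subst Unique (sym eV) uv , UP.map⁻ (subst Unique (sym eE) ue) ,
    subst (2 ≤_) (trans (cong length (sym eE)) (LP.length-map φ (H.edges w'))) len

  cycle-avoiding-cut : ∀ x' {v} (w : G.Walk v v) → G.Simple w → G.Uncrossing w → φ x' ∈ₗ G.edges w →
    ∃ λ K' → IsCycle I' K' × x' ∈ K'
  cycle-avoiding-cut x' {v} w simple nc mx = toSubset (H.edges w') , CyclesAsWalks.Simple⇒IsCycle I' w' simple' , ∈toSubset⁺ (∈-map-φ⁻ (subst (φ x' ∈ₗ_) (sym eE) mx))
    where
    sv : inS v ≡ false
    sv with true-or-false (inS v) | All.lookup (G.uncrossing-edges w nc) mx
    ... | inj₂ f | _ = f
    ... | inj₁ t | p1 , p2 = ⊥-elim (φ-not-inside x' (trans p1 t) (trans p2 t))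
    mw = map-walk w (All.map (λ e → trans e sv) (G.uncrossing-allv w nc))
    w' = proj₁ mw
    eE = proj₁ (proj₂ mw)
    eV = proj₂ (proj₂ mw)
    simple' = map-walk-Simple w w' eE eV simple

  module Cactus (crossing≤2 : ∀ xs → Unique xs → All (λ x → G.crossingᵇ x ≡ true) xs → length xs ≤ 2)
              (uniqueCycles : EveryEdgeInUniqueCycle I) where

    cycle-crossing-cut : ∀ x' {v z} (w : G.Walk v v) → G.Simple w → z ∈ₗ G.edges w → G.crossingᵇ z ≡ true →
      φ x' ∈ₗ G.edges w → ∃ λ K' → IsCycle I' K' × x' ∈ K'
    cycle-crossing-cut x' w simple mz cz mx with G.crossing-cycle-shape crossing≤2 w simple mz cz
    ... | G.mkC {a} {b} {b'} {a'} cx cy jx P jy Q sda sdb ncP ncQ crx cry uv ue covers = result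
      where
      sdb' : inS b' ≡ true
      sdb' = trans (G.uncrossing-end P ncP) sdb
      sda' : inS a' ≡ false
      sda' = trans (G.crossed⇒opposite-side jy cry) (cong not sdb')
      m1 = map-step jx (outside-end⇒kept jx sda)
      x1' = proj₁ m1
      e1 = proj₁ (proj₂ m1)
      j1 : Joins (H.ed x1') a r
      j1 = subst₂ (Joins (H.ed x1')) (red-outside sda) (red-inside sdb) (proj₂ (proj₂ m1))
      m2 = map-step jy (outside-end⇒kept (Joins-sym jy) sda')
      y1' = proj₁ m2
      e2 = proj₁ (proj₂ m2)
      j2 : Joins (H.ed y1') r a'
      j2 = subst₂ (Joins (H.ed y1')) (red-inside sdb') (red-outside sda') (proj₂ (proj₂ m2))
      allQ : All (λ z → inS z ≡ false) (G.allv Q)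
      allQ = All.map (λ e → trans e sda') (G.uncrossing-allv Q ncQ)
      mq = map-walk Q allQ
      Q' = proj₁ mq
      eQE = proj₁ (proj₂ mq)
      eQV = proj₂ (proj₂ mq)
      W' : H.Walk a a
      W' = H.step x1' j1 (H.step y1' j2 Q')
      uQ : Unique (a' ∷ G.verts Q)
      uQ = proj₁ (proj₂ (Unique-++⁻ (b ∷ G.verts P) uv))
      uvW : Unique (H.verts W')
      uvW = subst (λ l → Unique (r ∷ a' ∷ l)) (sym eQV) (All.map (λ f → r≢outside f) allQ ∷ uQ)
      eqmap : map φ (H.edges W') ≡ cx ∷ cy ∷ G.edges Q
      eqmap = cong₂ _∷_ e1 (cong₂ _∷_ e2 eQE)
      ueW : Unique (H.edges W')
      ueW = UP.map⁻ (subst Unique (sym eqmap) (Unique-drop-middle (G.edges P) (cy ∷ G.edges Q) ue))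
      simple' : H.Simple W'
      simple' = uvW , ueW , s≤s (s≤s z≤n)
      memx : x' ∈ₗ H.edges W'
      memx with covers mx
      ... | here e = here (φ-inj (trans e (sym e1)))
      ... | there m with MP.∈-++⁻ (G.edges P) m
      ...   | inj₁ mP = ⊥-elim (φ-not-inside x' (trans (proj₁ (All.lookup (G.uncrossing-edges P ncP) mP)) sdb) (trans (proj₂ (All.lookup (G.uncrossing-edges P ncP) mP)) sdb))
      ...   | inj₂ (here e) = there (here (φ-inj (trans e (sym e2))))
      ...   | inj₂ (there mQ) = there (there (∈-map-φ⁻ (subst (φ x' ∈ₗ_) (sym eQE) mQ)))
      result : ∃ λ K' → IsCycle I' K' × x' ∈ K'
      result = toSubset (H.edges W') , CyclesAsWalks.Simple⇒IsCycle I' W' simple' , ∈toSubset⁺ memx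

    cycle-through : ∀ x' → ∃ λ K' → IsCycle I' K' × x' ∈ K'
    cycle-through x' with proj₁ (uniqueCycles (φ x'))
    ... | K , isc , mK with CyclesAsWalks.IsCycle⇒walk I isc
    ... | CyclesAsWalks.mkCW w simple K→ _ with find-crossing (G.edges w)
    ... | inj₂ uncrossing = cycle-avoiding-cut x' w simple uncrossing (K→ mK)
    ... | inj₁ (z , mz , cz) = cycle-crossing-cut x' w simple mz cz (K→ mK)

    Joins-oriented : ∀ {e a b a' b'} → Joins e a b → Joins e a' b' → inS a ≡ false → inS b ≡ true → inS a' ≡ false → inS b' ≡ true → a ≡ a' × b ≡ b'
    Joins-oriented {p , q} (inj₁ (refl , refl)) (inj₁ (e1 , e2)) _ _ _ _ = e1 , e2
    Joins-oriented {p , q} (inj₁ (refl , refl)) (inj₂ (e1 , e2)) ha hb ha' hb' = ⊥-elim (true≢false (trans (sym hb') (trans (cong inS (sym e1)) ha)))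
    Joins-oriented {p , q} (inj₂ (refl , refl)) (inj₁ (e1 , e2)) ha hb ha' hb' = ⊥-elim (true≢false (trans (sym hb) (trans (cong inS e1) ha')))
    Joins-oriented {p , q} (inj₂ (refl , refl)) (inj₂ (e1 , e2)) _ _ _ _ = e2 , e1

    Joins-crossing : ∀ {e a b} → Joins e a b → inS a ≡ false → inS b ≡ true → crossesᵇ S e ≡ true
    Joins-crossing {p , q} (inj₁ (refl , refl)) f t rewrite f | t = refl
    Joins-crossing {p , q} (inj₂ (refl , refl)) f t rewrite f | t = refl

    record InsidePath {s t} (Pd : G.Walk s t) : Set where
      constructor mkPF
      field
        sides : All (λ z → inS z ≡ true) (G.allv Pd)
        uvP : Unique (G.allv Pd)
        ueP : Unique (G.edges Pd)
        ebP : All (λ z → inS (proj₁ (G.ed z)) ≡ true × inS (proj₂ (G.ed z)) ≡ true) (G.edges Pd)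

    InsidePath-rev : ∀ {s t} (Pd : G.Walk s t) → InsidePath Pd → InsidePath (G.rev Pd)
    InsidePath-rev Pd (mkPF sides uvP ueP ebP) = mkPF
      (subst (All _) (sym (G.allv-rev Pd)) (PP.All-resp-↭ (↭-sym (PP.↭-reverse (G.allv Pd))) sides))
      (subst Unique (sym (G.allv-rev Pd)) (Unique-resp-↭ (↭-sym (PP.↭-reverse (G.allv Pd))) uvP))
      (subst Unique (sym (G.edges-rev Pd)) (Unique-resp-↭ (↭-sym (PP.↭-reverse (G.edges Pd))) ueP))
      (subst (All _) (sym (G.edges-rev Pd)) (PP.All-resp-↭ (↭-sym (PP.↭-reverse (G.edges Pd))) ebP))

    record LiftedCycle (K' : Subset (length (E I'))) : Set where
      constructor mkL
      field
        {v} : Fin N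
        w : G.Walk v v
        simple : G.Simple w
        to : ∀ {y'} → y' ∈ K' → φ y' ∈ₗ G.edges w
        from : ∀ {y'} → φ y' ∈ₗ G.edges w → y' ∈ K'

    module CloseUp {K' : Subset (length (E I'))} {a₁ b₁ s1 s2 : Fin N} (x1 x2 : H.Ix) (R0 : H.Walk a₁ b₁)
           (uA : Unique (a₁ ∷ H.verts R0)) (ueR : Unique (x1 ∷ H.edges R0 ++ [ x2 ]))
           (toK : ∀ {y'} → y' ∈ K' → y' ∈ₗ (x1 ∷ H.edges R0 ++ [ x2 ]))
           (fromK : ∀ {y'} → y' ∈ₗ (x1 ∷ H.edges R0 ++ [ x2 ]) → y' ∈ K')
           (R0L : G.Walk a₁ b₁) (eRE : G.edges R0L ≡ map φ (H.edges R0)) (eRV : G.verts R0L ≡ H.verts R0)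
           (sidesR : All (λ z → inS z ≡ false) (H.verts R0)) (fa₁ : inS a₁ ≡ false)
           (J1 : Joins (G.ed (φ x1)) a₁ s1) (J2 : Joins (G.ed (φ x2)) b₁ s2)
           (Pd : G.Walk s2 s1) (pf : InsidePath Pd) where
      open InsidePath pf
      ER0 = H.edges R0
      EPd = G.edges Pd
      LW : G.Walk a₁ a₁
      LW = R0L G.++w G.step (φ x2) J2 (Pd G.++w G.step (φ x1) (Joins-sym J1) G.[])
      vL : G.verts LW ≡ G.verts R0L ++ s2 ∷ (G.verts Pd ++ [ a₁ ])
      vL = trans (G.verts-++ R0L _) (cong (λ l → G.verts R0L ++ s2 ∷ l) (G.verts-++ Pd _))
      eL : G.edges LW ≡ map φ ER0 ++ φ x2 ∷ (EPd ++ [ φ x1 ])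
      eL = trans (G.edges-++ R0L _) (cong₂ (λ l l' → l ++ φ x2 ∷ l') eRE (G.edges-++ Pd _))

      uER0 : Unique ER0
      uER0 = proj₁ (Unique-++⁻ ER0 (Unique-tail ueR))
      x1∉ : ∀ {y'} → y' ∈ₗ ER0 → x1 ≢ y'
      x1∉ m = head∉tail ueR (MP.∈-++⁺ˡ m)
      x2∉ : ∀ {y'} → y' ∈ₗ ER0 → y' ≢ x2
      x2∉ m refl = proj₂ (proj₂ (Unique-++⁻ ER0 (Unique-tail ueR))) m (here refl)
      x1≢x2 : x1 ≢ x2
      x1≢x2 = head∉tail ueR (MP.∈-++⁺ʳ ER0 (here refl))
      notPd : ∀ y' → φ y' ∈ₗ EPd → ⊥
      notPd y' m = φ-not-inside y' (proj₁ (All.lookup ebP m)) (proj₂ (All.lookup ebP m))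

      uTail : Unique (φ x2 ∷ (EPd ++ [ φ x1 ]))
      uTail = All.tabulate h ∷ Unique-++⁺ ueP ([] ∷ []) (λ { m (here refl) → notPd x1 m })
        where
        h : ∀ {z} → z ∈ₗ EPd ++ [ φ x1 ] → φ x2 ≢ z
        h m e with MP.∈-++⁻ EPd m
        ... | inj₁ mP = notPd x2 (subst (_∈ₗ EPd) (sym e) mP)
        ... | inj₂ (here e') = x1≢x2 (φ-inj (trans (sym e') (sym e)))
      uE : Unique (map φ ER0 ++ φ x2 ∷ (EPd ++ [ φ x1 ]))
      uE = Unique-++⁺ (UP.map⁺ φ-inj uER0) uTail dj
        where
        dj : ∀ {z} → z ∈ₗ map φ ER0 → z ∈ₗ φ x2 ∷ (EPd ++ [ φ x1 ]) → ⊥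
        dj m1 m2 with MP.∈-map⁻ φ m1
        ... | y' , my , refl with m2
        ...   | here e = x2∉ my (φ-inj e)
        ...   | there m3 with MP.∈-++⁻ EPd m3
        ...     | inj₁ mP = notPd y' mP
        ...     | inj₂ (here e) = x1∉ my (sym (φ-inj e))

      A = G.verts R0L
      uV : Unique (G.verts LW)
      uV = subst Unique (sym vL) (Unique-resp-↭ (↭-sym perm) (Unique-++⁺ uA' uvP dj))
        where
        perm : A ++ (s2 ∷ G.verts Pd ++ [ a₁ ]) ↭ (a₁ ∷ A) ++ (s2 ∷ G.verts Pd)
        perm = ↭-trans (↭-reflexive (sym (LP.++-assoc A (s2 ∷ G.verts Pd) [ a₁ ]))) (PP.++-comm (A ++ s2 ∷ G.verts Pd) [ a₁ ])
        uA' : Unique (a₁ ∷ A)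
        uA' = subst (λ l → Unique (a₁ ∷ l)) (sym eRV) uA
        sidesA : All (λ z → inS z ≡ false) (a₁ ∷ A)
        sidesA = fa₁ ∷ subst (All _) (sym eRV) sidesR
        dj : ∀ {z} → z ∈ₗ a₁ ∷ A → z ∈ₗ G.allv Pd → ⊥
        dj m1 m2 = true≢false (trans (sym (All.lookup sides m2)) (All.lookup sidesA m1))

      result : LiftedCycle K'
      result = mkL LW (uV , subst Unique (sym eL) uE , subst (2 ≤_) (cong length (sym eL)) (2≤length-++∷++[] (map φ ER0) (φ x2) EPd (φ x1))) to' from'
        where
        to' : ∀ {y'} → y' ∈ K' → φ y' ∈ₗ G.edges LW
        to' m with toK m
        ... | here refl = subst (_ ∈ₗ_) (sym eL) (MP.∈-++⁺ʳ (map φ ER0) (there (MP.∈-++⁺ʳ EPd (here refl))))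
        ... | there m' with MP.∈-++⁻ ER0 m'
        ...   | inj₁ m0 = subst (_ ∈ₗ_) (sym eL) (MP.∈-++⁺ˡ (MP.∈-map⁺ φ m0))
        ...   | inj₂ (here refl) = subst (_ ∈ₗ_) (sym eL) (MP.∈-++⁺ʳ (map φ ER0) (here refl))
        from' : ∀ {y'} → φ y' ∈ₗ G.edges LW → y' ∈ K'
        from' {y'} m with MP.∈-++⁻ (map φ ER0) (subst (_ ∈ₗ_) eL m)
        ... | inj₁ m0 = fromK (there (MP.∈-++⁺ˡ (∈-map-φ⁻ m0)))
        ... | inj₂ (here e) = fromK (there (MP.∈-++⁺ʳ ER0 (here (φ-inj e))))
        ... | inj₂ (there m3) with MP.∈-++⁻ EPd m3
        ...   | inj₁ mP = ⊥-elim (notPd y' mP)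
        ...   | inj₂ (here e) = fromK (here (φ-inj e))

    -- The cycle through the cut edge c₁ crosses the cut a second time, necessarily in the
    -- other cut edge c₂; its part inside S joins the inner ends of c₂ and c₁.
    inside-path : ∀ {c₁ c₂ a₁ s1 b₁ s2} → c₁ ≢ c₂ → Joins (G.ed c₁) a₁ s1 → Joins (G.ed c₂) b₁ s2 →
      inS a₁ ≡ false → inS s1 ≡ true → inS b₁ ≡ false → inS s2 ≡ true → Σ (G.Walk s2 s1) InsidePath
    inside-path {c₁} {c₂} {a₁} {s1} {b₁} {s2} c₁≢c₂ J1 J2 fa₁ ts1 fb₁ ts2 with proj₁ (uniqueCycles c₁)
    ... | K0 , isc0 , m0 with CyclesAsWalks.IsCycle⇒walk I isc0
    ... | CyclesAsWalks.mkCW w0 simple0 K→0 _ with G.crossing-cycle-shape crossing≤2 w0 simple0 (K→0 m0) (Joins-crossing J1 fa₁ ts1)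
    ... | G.mkC {a} {b} {b'} {a'} cx cy jx P jy Q sda sdb ncP ncQ crx cry uv ue covers = step3
      where
      cr1 = Joins-crossing J1 fa₁ ts1
      cr2 = Joins-crossing J2 fb₁ ts2
      sdb' : inS b' ≡ true
      sdb' = trans (G.uncrossing-end P ncP) sdb
      sda' : inS a' ≡ false
      sda' = trans (G.crossed⇒opposite-side jy cry) (cong not sdb')
      pfP : InsidePath P
      pfP = mkPF (All.map (λ e → trans e sdb) (G.uncrossing-allv P ncP))
                 (proj₁ (Unique-++⁻ (b ∷ G.verts P) uv))
                 (proj₁ (Unique-++⁻ (G.edges P) (Unique-tail ue)))
                 (All.map (λ { (p , q) → trans p sdb , trans q sdb }) (G.uncrossing-edges P ncP))
      cx≢cy : cx ≢ cy
      cx≢cy = head∉tail ue (MP.∈-++⁺ʳ (G.edges P) (here refl))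
      cls1 : c₁ ≡ cx ⊎ c₁ ≡ cy
      cls1 with covers (K→0 m0)
      ... | here e = inj₁ e
      ... | there m with MP.∈-++⁻ (G.edges P) m
      ...   | inj₁ mP = ⊥-elim (true≢false (trans (sym cr1) (All.lookup ncP mP)))
      ...   | inj₂ (here e) = inj₂ e
      ...   | inj₂ (there mQ) = ⊥-elim (true≢false (trans (sym cr1) (All.lookup ncQ mQ)))
      cls2 : c₂ ≡ cx ⊎ c₂ ≡ cy
      cls2 with c₂ FP.≟ cx | c₂ FP.≟ cy
      ... | yes e | _ = inj₁ e
      ... | no _ | yes e = inj₂ e
      ... | no n1 | no n2 = ⊥-elim (3≰2 (crossing≤2 (cx ∷ cy ∷ c₂ ∷ [])
              ((cx≢cy ∷ (λ e → n1 (sym e)) ∷ []) ∷ (((λ e → n2 (sym e)) ∷ []) ∷ ([] ∷ [])))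
              (crx ∷ cry ∷ cr2 ∷ [])))
      finA : ∀ {p q} (P' : G.Walk p q) → InsidePath P' → p ≡ s1 → q ≡ s2 → Σ (G.Walk s2 s1) InsidePath
      finA P' pf refl refl = G.rev P' , InsidePath-rev P' pf
      finB : ∀ {p q} (P' : G.Walk p q) → InsidePath P' → p ≡ s2 → q ≡ s1 → Σ (G.Walk s2 s1) InsidePath
      finB P' pf refl refl = P' , pf
      step3 : Σ (G.Walk s2 s1) InsidePath
      step3 with cls1 | cls2
      ... | inj₁ e1 | inj₁ e2 = ⊥-elim (c₁≢c₂ (trans e1 (sym e2)))
      ... | inj₂ e1 | inj₂ e2 = ⊥-elim (c₁≢c₂ (trans e1 (sym e2)))
      ... | inj₁ e1 | inj₂ e2 = finA P pfP (proj₂ d1) (proj₂ d2)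
        where
        d1 = Joins-oriented jx (subst (λ z → Joins (G.ed z) a₁ s1) e1 J1) sda sdb fa₁ ts1
        d2 = Joins-oriented (Joins-sym jy) (subst (λ z → Joins (G.ed z) b₁ s2) e2 J2) sda' sdb' fb₁ ts2
      ... | inj₂ e1 | inj₁ e2 = finB P pfP (proj₂ d2) (proj₂ d1)
        where
        d1 = Joins-oriented (Joins-sym jy) (subst (λ z → Joins (G.ed z) a₁ s1) e1 J1) sda' sdb' fa₁ ts1
        d2 = Joins-oriented jx (subst (λ z → Joins (G.ed z) b₁ s2) e2 J2) sda sdb fb₁ ts2

    lift-avoiding-r : ∀ {K' v} (w : H.Walk v v) → H.Simple w → ¬ (r ∈ₗ H.verts w) →
      (∀ {y'} → y' ∈ K' → y' ∈ₗ H.edges w) → (∀ {y'} → y' ∈ₗ H.edges w → y' ∈ K') → LiftedCycle K'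
    lift-avoiding-r {v = v} w (uv , ue , len) r∉ K→ →K =
      mkL wl (subst Unique (sym eV) uv , subst Unique (sym eE) (UP.map⁺ φ-inj ue) ,
              subst (2 ≤_) (sym (trans (cong length eE) (LP.length-map φ (H.edges w)))) len)
          (λ m → subst (_ ∈ₗ_) (sym eE) (MP.∈-map⁺ φ (K→ m)))
          (λ m → →K (∈-map-φ⁻ (subst (_ ∈ₗ_) eE m)))
      where
      v≢r : v ≢ r
      v≢r e = r∉ (subst (_∈ₗ H.verts w) e (H.last∈verts w (ℕP.≤-trans (s≤s z≤n) len)))
      avoids : All (_≢ r) (H.allv w)
      avoids = v≢r ∷ All.tabulate (λ {z} m e → r∉ (subst (_∈ₗ H.verts w) e m))
      lw = lift-walk w avoids
      wl = proj₁ lw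
      eE = proj₁ (proj₂ lw)
      eV = proj₁ (proj₂ (proj₂ lw))

    -- Rotated to start at r, the cycle is x1 R0 x2 with R0 avoiding r; lifted, R0 runs outside S
    -- and the inner ends of x1 and x2 are joined inside S by inside-path.
    lift-through-r : ∀ {K'} (w : H.Walk r r) → H.Simple w → (∀ {y'} → y' ∈ K' → y' ∈ₗ H.edges w) →
                     (∀ {y'} → y' ∈ₗ H.edges w → y' ∈ K') → LiftedCycle K'
    lift-through-r H.[] (_ , _ , ()) _ _
    lift-through-r (H.step x1 j1 H.[]) (_ , _ , s≤s ()) _ _
    lift-through-r {K'} (H.step {b = a₁} x1 j1 R@(H.step _ _ _)) (uv , ue , _) toR fromR with H.last-step R (s≤s z≤n)
    ... | H.mkLS {b₁} x2 j2 R0 eE eV = final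
      where
      uvR : Unique (a₁ ∷ H.verts R0 ++ [ r ])
      uvR = subst (λ l → Unique (a₁ ∷ l)) eV uv
      ueR : Unique (x1 ∷ H.edges R0 ++ [ x2 ])
      ueR = subst (λ l → Unique (x1 ∷ l)) eE ue
      spl = Unique-++⁻ (a₁ ∷ H.verts R0) uvR
      uA = proj₁ spl
      allNR : All (_≢ r) (H.allv R0)
      allNR = All.tabulate (λ {z} m e → proj₂ (proj₂ spl) (subst (_∈ₗ _) e m) (here refl))
      a₁≢r : a₁ ≢ r
      a₁≢r = All.head allNR
      b₁≢r : b₁ ≢ r
      b₁≢r = All.lookup allNR (H.end∈allv R0)
      toK : ∀ {y'} → y' ∈ K' → y' ∈ₗ (x1 ∷ H.edges R0 ++ [ x2 ])
      toK m = subst (λ l → _ ∈ₗ x1 ∷ l) eE (toR m)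
      fromK : ∀ {y'} → y' ∈ₗ (x1 ∷ H.edges R0 ++ [ x2 ]) → y' ∈ K'
      fromK m = fromR (subst (λ l → _ ∈ₗ x1 ∷ l) (sym eE) m)
      lr = lift-walk R0 allNR
      x1≢x2 : x1 ≢ x2
      x1≢x2 = head∉tail ueR (MP.∈-++⁺ʳ (H.edges R0) (here refl))
      final : LiftedCycle K'
      final with lift-step-to-r (Joins-sym j1) a₁≢r | lift-step-to-r j2 b₁≢r
      ... | s1 , ts1 , J1 , fa₁ | s2 , ts2 , J2 , fb₁ =
        CloseUp.result {K'} x1 x2 R0 uA ueR toK fromK (proj₁ lr) (proj₁ (proj₂ lr))
          (proj₁ (proj₂ (proj₂ lr))) (proj₂ (proj₂ (proj₂ lr))) fa₁ J1 J2 (proj₁ path) (proj₂ path)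
        where
        path = inside-path (λ e → x1≢x2 (φ-inj e)) J1 J2 fa₁ ts1 fb₁ ts2

    lift-cycle : ∀ {K'} → IsCycle I' K' → LiftedCycle K'
    lift-cycle isc with CyclesAsWalks.IsCycle⇒walk I' isc
    ... | CyclesAsWalks.mkCW w simple K→ →K with r ∈? H.verts w
    ... | no r∉ = lift-avoiding-r w simple r∉ K→ →K
    ... | yes r∈ with H.rotate-to-vertex w r∈
    ...   | H.mkRV w' pE pV =
      lift-through-r w' (H.Simple-resp-↭ w' w pE pV simple) (λ m → PP.∈-resp-↭ (↭-sym pE) (K→ m)) (λ m → →K (PP.∈-resp-↭ pE m))

    cycle-unique : ∀ x' K1 K2 → IsCycle I' K1 → IsCycle I' K2 → x' ∈ K1 → x' ∈ K2 → K1 ≡ K2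
    cycle-unique x' K1 K2 i1 i2 m1 m2 with lift-cycle i1 | lift-cycle i2
    ... | mkL w1 g1 to1 from1 | mkL w2 g2 to2 from2 = SP.⊆-antisym sub12 sub21
      where
      C12 : toSubset (G.edges w1) ≡ toSubset (G.edges w2)
      C12 = proj₂ (uniqueCycles (φ x')) _ _ (CyclesAsWalks.Simple⇒IsCycle I w1 g1) (CyclesAsWalks.Simple⇒IsCycle I w2 g2) (∈toSubset⁺ (to1 m1)) (∈toSubset⁺ (to2 m2))
      sub12 : K1 ⊆ K2
      sub12 m = from2 (∈toSubset⁻ (subst (_ ∈_) C12 (∈toSubset⁺ (to1 m))))
      sub21 : K2 ⊆ K1
      sub21 m = from1 (∈toSubset⁻ (subst (_ ∈_) (sym C12) (∈toSubset⁺ (to2 m))))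

    contract-EveryEdgeInUniqueCycle : EveryEdgeInUniqueCycle I'
    contract-EveryEdgeInUniqueCycle x' = cycle-through x' , cycle-unique x'

nonLeafEndpointᵇ : ∀ {N} → Instance N → Fin N → Bool
nonLeafEndpointᵇ I v = lookup (V I) v ∧ endpointᵇ I v ∧ not (leafᵇ I v)

module ContractionAtCut {N : ℕ} (I : Instance N) (S : Subset N) (r : Fin N) (r∈S : lookup S r ≡ true)
                        (δ≡2 : length (δE I S) ≡ 2) where
  open Contraction I S r r∈S

  deg-r≡2 : deg I' r ≡ 2
  deg-r≡2 = trans deg-r≡|δE| δ≡2

  lookup-⁅r⁆ : ∀ {v} → v ≢ r → lookup ⁅ r ⁆ v ≡ false
  lookup-⁅r⁆ v≢r = BP.¬-not (λ e → v≢r (SP.x∈⁅y⁆⇒x≡y r (lookup⇒∈ e)))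

  lookup-V'-outside : ∀ {v} → inS v ≡ false → lookup V' v ≡ lookup (V I) v
  lookup-V'-outside {v} f
    rewrite lookup-∪ (V I ─ S) ⁅ r ⁆ v | lookup-─ (V I) S v | f | lookup-⁅r⁆ (λ e → r≢outside f (sym e)) =
    trans (BP.∨-identityʳ _) (BP.∧-identityʳ _)

  nonLeafEndpointᵇ-outside : ∀ {v} → inS v ≡ false → nonLeafEndpointᵇ I' v ≡ nonLeafEndpointᵇ I v
  nonLeafEndpointᵇ-outside f rewrite lookup-V'-outside f | endpointᵇ-outside f | deg-outside f = refl

  nonLeafEndpointᵇ-inside : ∀ {v} → inS v ≡ true → nonLeafEndpointᵇ I' v ≡ false
  nonLeafEndpointᵇ-inside {v} t with v FP.≟ r
  ... | yes refl rewrite ∈V'⁺ (inj₂ refl) | deg-r≡2 = BP.∧-zeroʳ _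
  ... | no v≢r rewrite lookup-∪ (V I ─ S) ⁅ r ⁆ v | lookup-─ (V I) S v | t | lookup-⁅r⁆ v≢r
                     | BP.∧-zeroʳ (lookup (V I) v) = refl

  red-Leaf : ∀ {p} → Leaf I p → Leaf I' (red p)
  red-Leaf {p} (p∈V , deg≡2) with true-or-false (inS p)
  ... | inj₁ t rewrite red-inside t = lookup⇒∈ (∈V'⁺ (inj₂ refl)) , deg-r≡2
  ... | inj₂ f rewrite red-outside f = lookup⇒∈ (∈V'⁺ (inj₁ (∈⇒lookup p∈V , f))) , trans (deg-outside f) deg≡2

  contract-LeafToLeaf : LeafToLeaf I → LeafToLeaf I'
  contract-LeafToLeaf ltl l m with MP.∈-map⁻ redirectPair m
  ... | e , m₀ , refl with ltl e (proj₁ (∈-filterᵇ⁻ keptᵇ (L I) m₀))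
  ...   | leaf₁ , leaf₂ = red-Leaf leaf₁ , red-Leaf leaf₂

  crossing-edges≤2 : ∀ xs → Unique xs → All (λ x → crossesᵇ S (List.lookup (E I) x) ≡ true) xs → length xs ≤ 2
  crossing-edges≤2 xs u crossing = subst (length xs ≤_) (trans (length-filter-indices (crossesᵇ S) (E I)) δ≡2)
    (Unique-⊆⇒length≤ u (λ {z} m → ∈-filterᵇ⁺ (crossesᵇ S ∘ List.lookup (E I)) (MP.∈-allFin z) (All.lookup crossing m)))

  contract-CacAP : S ⊆ V I → CacAP I → CacAP I'
  contract-CacAP S⊆V ((eb , conn , ee) , lb) =
    ( contractList-InBinom (E I) eb
    , contract-Connected S⊆V conn
    , ContractCycles.Cactus.contract-EveryEdgeInUniqueCycle I S r r∈S crossing-edges≤2 ee)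
    , contractList-InBinom (L I) lb

-- Splitting at a two-edge cut

δE-complement : ∀ {N} (I : Instance N) (C : Subset N) → (∀ e → e ∈ₗ E I → InBinom (V I) e) →
  δE I (V I ─ C) ≡ δE I C
δE-complement I C binom = filterᵇ-cong (crossesᵇ (V I ─ C)) (crossesᵇ C) (E I) same
  where
  same : ∀ e → e ∈ₗ E I → crossesᵇ (V I ─ C) e ≡ crossesᵇ C e
  same (p , q) m with binom (p , q) m
  ... | p∈V , q∈V , _ rewrite lookup-─ (V I) C p | lookup-─ (V I) C q | ∈⇒lookup p∈V | ∈⇒lookup q∈V
    with lookup C p | lookup C q
  ... | true  | true  = refl
  ... | true  | false = refl
  ... | false | true  = refl
  ... | false | false = refl

nonLeafEndpoints-split : ∀ {N} (I : Instance N) (C : Subset N) (c u : Fin N) →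
  (u∈C̄ : lookup (V I ─ C) u ≡ true) (c∈C : lookup C c ≡ true) →
  length (δE I (V I ─ C)) ≡ 2 → length (δE I C) ≡ 2 →
  nonLeafEndpoints (splitC I C u) + nonLeafEndpoints (splitCompl I C c) ≡ nonLeafEndpoints I
nonLeafEndpoints-split {N} I C c u u∈C̄ c∈C δC̄ δC =
  length-filter-∨-disjoint (nonLeafEndpointᵇ (splitC I C u)) (nonLeafEndpointᵇ (splitCompl I C c))
    (nonLeafEndpointᵇ I) (λ v → proj₁ (pointwise v)) (λ v → proj₂ (pointwise v)) (allFin N)
  where
  module Outer = ContractionAtCut I (V I ─ C) u u∈C̄ δC̄
  module Inner = ContractionAtCut I C c c∈C δC
  pointwise : ∀ v → (nonLeafEndpointᵇ (splitC I C u) v ∧ nonLeafEndpointᵇ (splitCompl I C c) v) ≡ false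
                  × nonLeafEndpointᵇ I v ≡ (nonLeafEndpointᵇ (splitC I C u) v ∨ nonLeafEndpointᵇ (splitCompl I C c) v)
  pointwise v with true-or-false (lookup C v) | true-or-false (lookup (V I) v)
  ... | inj₁ c | _ rewrite Outer.nonLeafEndpointᵇ-outside (lookup-─-inside (V I) C c)
                         | Inner.nonLeafEndpointᵇ-inside c = BP.∧-zeroʳ _ , sym (BP.∨-identityʳ _)
  ... | inj₂ c | inj₁ v∈V rewrite Outer.nonLeafEndpointᵇ-inside (trans (lookup-─-outside (V I) C c) v∈V)
                               | Inner.nonLeafEndpointᵇ-outside c = refl , refl
  ... | inj₂ c | inj₂ v∉V rewrite Outer.nonLeafEndpointᵇ-outside (trans (lookup-─-outside (V I) C c) v∉V)
                               | Inner.nonLeafEndpointᵇ-outside c | v∉V = refl , refl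

lemma18 : ∀ {N} (I : Instance N) (C : Subset N) (c u : Fin N) →
    CacAP I → C ⊆ V I → c ∈ C → u ∈ V I → u ∉ C →
    length (δE I C) ≡ 2 →
      (LeafToLeaf I →
          (CacAP (splitC I C u) × LeafToLeaf (splitC I C u))
        × (CacAP (splitCompl I C c) × LeafToLeaf (splitCompl I C c)))
    × (nonLeafEndpoints (splitC I C u) + nonLeafEndpoints (splitCompl I C c)
        ≡ nonLeafEndpoints I)
lemma18 I C c u cac C⊆V c∈C u∈V u∉C δC =
    (λ ltl → (Outer.contract-CacAP (─⊆ (V I) C) cac , Outer.contract-LeafToLeaf ltl)
           , (Inner.contract-CacAP C⊆V cac , Inner.contract-LeafToLeaf ltl))
  , nonLeafEndpoints-split I C c u u∈C̄ (∈⇒lookup c∈C) δC̄ δC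
  where
  u∈C̄ : lookup (V I ─ C) u ≡ true
  u∈C̄ = trans (lookup-─-outside (V I) C (∉⇒lookup u∉C)) (∈⇒lookup u∈V)
  δC̄ : length (δE I (V I ─ C)) ≡ 2
  δC̄ = trans (cong length (δE-complement I C (proj₁ (proj₁ cac)))) δC
  module Outer = ContractionAtCut I (V I ─ C) u u∈C̄ δC̄
  module Inner = ContractionAtCut I C c (∈⇒lookup c∈C) δC
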